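{- Let $G$ and $H$ be two finite simple graphs on a common vertex set $V$ of size $n$ such that $\deg_G(v)=\deg_H(v)$ for every $v\in V$. If the $2$-dimensional Weisfeiler--Leman algorithm cannot distinguish $G$ and $H$ (i.e. $G\cong_{2\text{ -WL}}H$), then $G$ and $H$ share the generalized block Laplacian spectrum, i.e. $G\cong_{GBLS}H$.
   Context: Graphs are finite, simple, undirected; $A_G$ denotes the adjacency matrix. $2$-WL equivalence. For a matrix $A:V\times V\to C$ and $k\ge1$, the atomic type $\mathrm{tp}_A(i_1,\dots,i_k)$ of a $k$-tuple is the $k\times k$ array $T$ with $T_{p,q}=(0,A(i_p,i_q))$ if $i_p=i_q$ and $(1,A(i_p,i_q))$ if $i_p\neq i_q$. Set $X^1_{A,k}=\mathrm{tp}_A$ and $X^{r+1}_{A,k}(i_1\dots i_k)=\big(X^r_{A,k}(i_1\dots i_k),\ \{\!\{(\mathrm{tp}_A(i_1\dots i_k m),S^r_{A,k}(i_1\dots i_km)):m\in V\}\!\}\big)$, where $\{\!\{\cdot\}\!\}$ is a multiset and $S^r_{A,k}(i_1\dots i_km)$ is the sequence of colors $X^r_{A,k}$ of the tuples obtained from $(i_1,\dots,i_k)$ by replacing its $\ell$-th entry by $m$, for $\ell=k,\dots,1$. Let $M^r_{A,k}=\{\!\{X^r_{A,k}(x):x\in V^k\}\!\}$ and $I_{A,k}(t)=\sum_{r\ge1}t^rM^r_{A,k}$. Then $G\cong_{2\text{ -WL}}H$ means $I_{A_G,2}(t)=I_{A_H,2}(t)$. Generalized block Laplacian spectrum. For $G,H$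 on $V$ with $\deg_G(v)=\deg_H(v)$ for all $v$, let $V=\bigsqcup_{i=1}^pV_i$ be the partition into degree classes, $e_i\in\{0,1\}^V$ the characteristic vector of $V_i$, and $J_{i,j}=e_ie_j^\top$. For a tuple $\mathbf A=(A_1,\dots,A_k)$ of $n\times n$ matrices and variables $\mathbf s=(s_1,\dots,s_k)$ put $W_{\mathbf A}(\mathbf s)=\sum_i s_iA_i$ and $\phi_{\mathbf A}(\mathbf s;t)=\det(tI-W_{\mathbf A}(\mathbf s))$. Then $G\cong_{GBLS}H$ means $\phi_{\mathbf A}(\mathbf s;t)=\phi_{\mathbf B}(\mathbf s;t)$ as polynomials, where $\mathbf A=(A_G,J_{1,1},J_{1,2},\dots,J_{p,p})$ and $\mathbf B=(A_H,J_{1,1},J_{1,2},\dots,J_{p,p})$ (all $p^2$ matrices $J_{i,j}$). -}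

module Defs where

open import Level using (0ℓ)
open import Data.Nat using (ℕ; zero; suc)
open import Data.Bool using (Bool; true; false; not; if_then_else_)
open import Data.Product using (Σ; Σ-syntax; _×_; _,_; ∃)
open import Data.Fin using (Fin; zero; suc; punchIn)
open import Data.Fin.Properties using (_≟_)
open import Data.Vec using (Vec; []; _∷_; lookup; tabulate; _∷ʳ_; _[_]≔_; sum)
open import Relation.Nullary.Decidable using (⌊_⌋)
open import Relation.Binary.PropositionalEquality using (_≡_)
open import Function.Bundles using (_↔_; Inverse; _⇔_)
open import Algebra.Bundles using (CommutativeRing)

record Graph (n : ℕ) : Set where
  field
    adj    : Fin n → Fin n → Bool
    sym    : ∀ i j → adj i j ≡ adj j i
    irrefl : ∀ i → adj i i ≡ false
open Graph public

AdjMat : ∀ {n} → Graph n → Fin n → Fin n → ℕ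
AdjMat G i j = if adj G i j then 1 else 0

deg : ∀ {n} → Graph n → Fin n → ℕ
deg G v = sum (tabulate (AdjMat G v))

-- atomic type tp_A(i_1..i_k): the k×k array with entries
-- (0 , A(i_p,i_q)) if i_p = i_q and (1 , A(i_p,i_q)) otherwise
-- (0 encoded as false, 1 as true)
tp : ∀ {n k} {C : Set} → (Fin n → Fin n → C) → Vec (Fin n) k → Vec (Vec (Bool × C) k) k
tp A xs = tabulate λ p → tabulate λ q →
  (not ⌊ lookup xs p ≟ lookup xs q ⌋ , A (lookup xs p) (lookup xs q))

-- SameX A B r x y  expresses  X^{r+1}_{A,k}(x) = X^{r+1}_{B,k}(y).
-- Equality of the multisets {{ f m : m ∈ V }} = {{ g m : m ∈ V }} is
-- written out as the existence of a bijection π of V with f m = g (π m);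
-- equality of the sequences S^r is componentwise (over ℓ).
SameX : ∀ {n k} {C : Set} → (A B : Fin n → Fin n → C) → ℕ →
        Vec (Fin n) k → Vec (Fin n) k → Set
SameX A B zero    x y = tp A x ≡ tp B y
SameX {n} {k} A B (suc r) x y =
  SameX A B r x y ×
  Σ[ π ∈ Fin n ↔ Fin n ]
    (∀ m → tp A (x ∷ʳ m) ≡ tp B (y ∷ʳ Inverse.to π m)
         × (∀ (ℓ : Fin k) → SameX A B r (x [ ℓ ]≔ m) (y [ ℓ ]≔ Inverse.to π m)))

-- M^{r+1}_{A,k} = M^{r+1}_{B,k} (equality of multisets over V^k, written
-- out via a bijection of V^k)
SameM : ∀ {n} (k : ℕ) {C : Set} → (A B : Fin n → Fin n → C) → ℕ → Set
SameM {n} k A B r =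
  Σ[ σ ∈ Vec (Fin n) k ↔ Vec (Fin n) k ] (∀ x → SameX A B r x (Inverse.to σ x))

-- I_{A,k}(t) = I_{B,k}(t): all coefficients M^r (r ≥ 1) agree
WLEquiv : ∀ {n} (k : ℕ) {C : Set} → (A B : Fin n → Fin n → C) → Set
WLEquiv k A B = ∀ r → SameM k A B r

WL2Equiv : ∀ {n} → Graph n → Graph n → Set
WL2Equiv G H = WLEquiv 2 (AdjMat G) (AdjMat H)

module MatrixDefs {c ℓ} (R : CommutativeRing c ℓ) where
  open CommutativeRing R using (Carrier; _+_; _*_; -_; _-_; 0#; 1#)

  ∑ : ∀ {m} → (Fin m → Carrier) → Carrier
  ∑ {zero}  f = 0#
  ∑ {suc m} f = f zero + ∑ (λ i → f (suc i))

  altSign : ℕ → Carrier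
  altSign zero    = 1#
  altSign (suc j) = - altSign j

  toℕ' : ∀ {m} → Fin m → ℕ
  toℕ' zero    = zero
  toℕ' (suc i) = suc (toℕ' i)

  det : ∀ {m} → (Fin m → Fin m → Carrier) → Carrier
  det {zero}  M = 1#
  det {suc m} M =
    ∑ (λ j → altSign (toℕ' j) * (M zero j * det (λ a b → M (suc a) (punchIn j b))))

  ind : Bool → Carrier
  ind true  = 1#
  ind false = 0#

  charMat : ∀ {m} → (Fin m → Fin m → Carrier) → Carrier → Fin m → Fin m → Carrier
  charMat W t i j = (t * ind ⌊ i ≟ j ⌋) - W i j

  Jmat : ∀ {m p} → (Fin m → Fin p) → Fin p → Fin p → Fin m → Fin m → Carrier
  Jmat cls a b i j = ind ⌊ cls i ≟ a ⌋ * ind ⌊ cls j ≟ b ⌋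

  Wmat : ∀ {m p} → Graph m → (Fin m → Fin p) → Carrier → (Fin p → Fin p → Carrier) →
         Fin m → Fin m → Carrier
  Wmat G cls s₀ s i j =
    s₀ * ind (adj G i j) + ∑ (λ a → ∑ (λ b → s a b * Jmat cls a b i j))

  φ : ∀ {m p} → Graph m → (Fin m → Fin p) → Carrier → (Fin p → Fin p → Carrier) →
      Carrier → Carrier
  φ G cls s₀ s t = det (charMat (Wmat G cls s₀ s) t)

-- Equality of the polynomials φ_A(s;t) and φ_B(s;t) in ℤ[s;t], expressed
-- through its universal property: equality after substituting arbitrary
-- elements of an arbitrary commutative ring (taking R = ℤ[s;t] itself and
-- the variables as values recovers polynomial identity).
GBLSEquiv : ∀ {n p} → Graph n → Graph n → (Fin n → Fin p) → Set₁
GBLSEquiv {n} {p} G H cls =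
  (R : CommutativeRing 0ℓ 0ℓ) →
  let open CommutativeRing R using (Carrier; _≈_)
      open MatrixDefs R using (φ)
  in (s₀ : Carrier) (s : Fin p → Fin p → Carrier) (t : Carrier) →
     φ G cls s₀ s t ≈ φ H cls s₀ s t

IsDegreePartition : ∀ {n p} → Graph n → (Fin n → Fin p) → Set
IsDegreePartition {n} {p} G cls =
  (∀ (a : Fin p) → ∃ λ v → cls v ≡ a) ×
  (∀ (u v : Fin n) → (cls u ≡ cls v) ⇔ (deg G u ≡ deg G v))

{-# OPTIONS --safe #-}

-- The entry of W = s₀ A + Σ s_ab J_ab at a pair of vertices depends only on adjacency and on the
-- degree classes of the two endpoints, which 2-WL sees after one round; round k + 1 provides
-- bijections matching the terms of (W^(k+1))_ab = Σ_m (W^k)_am W_mb one by one.  Hence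
-- tr W_G^k = tr W_H^k for all k, over any commutative ring.  Over the torsion-free ring ℤ[s]
-- Newton's identities, derived from Jacobi's formula and the adjugate, recover det (t I − W)
-- from these traces; substituting values for s₀, s_ab in an arbitrary ring gives φ_G = φ_H.

module Submission where

import Algebra.Properties.CommutativeMonoid.Mult
import Algebra.Properties.CommutativeMonoid.Sum
import Algebra.Properties.CommutativeSemigroup
import Algebra.Properties.Monoid.Mult
import Algebra.Properties.Semiring.Mult
import Algebra.Properties.Semiring.Sum
open import Algebra.Bundles using (CommutativeRing)
open import Data.Bool using (Bool; true; false; not; if_then_else_)
open import Data.Bool.Properties using (not-injective)
open import Data.Fin using (Fin; zero; suc; punchIn; inject₁; toℕ; combine; remQuot; _↑ˡ_; _↑ʳ_)
open import Data.Fin.Permutation using (Permutation)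
open import Data.Fin.Properties using (_≟_; *↔×; remQuot-combine)
open import Data.List using (List; []; _∷_)
open import Data.Nat as ℕ using (ℕ; zero; suc; _∸_; _≤_; _<_; z≤n; s≤s)
import Data.Nat.Properties as ℕ
open import Data.Product using (_,_; proj₁; proj₂)
open import Data.Sum using (inj₁; inj₂)
open import Data.Vec as Vec using (Vec; []; _∷_; lookup; tabulate)
open import Data.Vec.Functional using (updateAt)
open import Data.Vec.Functional.Properties using (updateAt-updates; updateAt-minimal; updateAt-id-local; updateAt-commutes; map-updateAt)
open import Function using (_∘_; const; _↔_; Inverse; mk↔ₛ′; Equivalence)
open import Function.Construct.Composition using (_↔-∘_)
open import Function.Construct.Symmetry using (↔-sym)
open import Level using (Level; 0ℓ; _⊔_)
open import Relation.Binary.PropositionalEquality as ≡ using (_≡_; _≢_)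
open import Relation.Nullary.Decidable using (⌊_⌋; yes; no; ⌊⌋-map′)
open import Relation.Nullary.Negation using (contradiction)
open import Defs using (Graph; adj; AdjMat; deg; SameX; WL2Equiv; IsDegreePartition; GBLSEquiv; module MatrixDefs)

private
  variable
    ℓ₁ ℓ₂ ℓ₃ ℓ₄ : Level

  module ℕΣ = Algebra.Properties.CommutativeMonoid.Sum ℕ.+-0-commutativeMonoid

  sum-ones : ∀ n → ℕΣ.sum {n} (λ _ → 1) ≡ n
  sum-ones zero    = ≡.refl
  sum-ones (suc n) = ≡.cong suc (sum-ones n)


⌊suc≟suc⌋ : ∀ {m} (i j : Fin m) → ⌊ suc i ≟ suc j ⌋ ≡ ⌊ i ≟ j ⌋
⌊suc≟suc⌋ i j = ⌊⌋-map′ _ _ (i ≟ j)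

⌊≟⌋-refl : ∀ {m} (i : Fin m) → ⌊ i ≟ i ⌋ ≡ true
⌊≟⌋-refl i with i ≟ i
... | yes _   = ≡.refl
... | no i≢i = contradiction ≡.refl i≢i

⌊≟⌋-sym : ∀ {m} (i j : Fin m) → ⌊ i ≟ j ⌋ ≡ ⌊ j ≟ i ⌋
⌊≟⌋-sym i j with i ≟ j | j ≟ i
... | yes _   | yes _   = ≡.refl
... | no _    | no _    = ≡.refl
... | yes i≡j | no j≢i  = contradiction (≡.sym i≡j) j≢i
... | no i≢j  | yes j≡i = contradiction (≡.sym j≡i) i≢j

module Summation (R : CommutativeRing ℓ₁ ℓ₂) where

  open CommutativeRing R hiding (zero)
  open MatrixDefs R
  private module Sum = Algebra.Properties.Semiring.Sum semiring
  open Sum using (sum)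
  open import Algebra.Properties.Ring ring using (-0#≈0#; -‿+-comm)
  open import Relation.Binary.Reasoning.Setoid setoid

  open import Algebra.Properties.Monoid.Mult +-monoid using (_×_)

  ×-zeroʳ : ∀ n → n × 0# ≈ 0#
  ×-zeroʳ zero    = refl
  ×-zeroʳ (suc n) = trans (+-identityˡ _) (×-zeroʳ n)

  ∑≡sum : ∀ {m} (f : Fin m → Carrier) → ∑ f ≡ sum f
  ∑≡sum {zero}  f = ≡.refl
  ∑≡sum {suc m} f = ≡.cong (f zero +_) (∑≡sum (f ∘ suc))

  private
    viaSum : ∀ {m k} (f : Fin m → Carrier) (g : Fin k → Carrier) → sum f ≈ sum g → ∑ f ≈ ∑ g
    viaSum f g e = begin
      ∑ f   ≡⟨ ∑≡sum f ⟩
      sum f ≈⟨ e ⟩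
      sum g ≡⟨ ∑≡sum g ⟨
      ∑ g   ∎

  ∑-cong : ∀ {m} {f g : Fin m → Carrier} → (∀ i → f i ≈ g i) → ∑ f ≈ ∑ g
  ∑-cong {f = f} {g} e = viaSum f g (Sum.sum-cong-≋ e)

  ∑-zero : ∀ {m} {f : Fin m → Carrier} → (∀ i → f i ≈ 0#) → ∑ f ≈ 0#
  ∑-zero {zero}  e = refl
  ∑-zero {suc m} e = trans (+-cong (e zero) (∑-zero (e ∘ suc))) (+-identityˡ 0#)

  ∑-+ : ∀ {m} (f g : Fin m → Carrier) → ∑ (λ i → f i + g i) ≈ ∑ f + ∑ g
  ∑-+ f g = begin
    ∑ (λ i → f i + g i)   ≡⟨ ∑≡sum (λ i → f i + g i) ⟩
    sum (λ i → f i + g i) ≈⟨ Sum.∑-distrib-+ f g ⟩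
    sum f + sum g         ≡⟨ ≡.cong₂ _+_ (∑≡sum f) (∑≡sum g) ⟨
    ∑ f + ∑ g             ∎

  ∑-*ˡ : ∀ {m} x (f : Fin m → Carrier) → x * ∑ f ≈ ∑ (λ i → x * f i)
  ∑-*ˡ x f = begin
    x * ∑ f             ≡⟨ ≡.cong (x *_) (∑≡sum f) ⟩
    x * sum f           ≈⟨ Sum.*-distribˡ-sum x f ⟩
    sum (λ i → x * f i) ≡⟨ ∑≡sum (λ i → x * f i) ⟨
    ∑ (λ i → x * f i)   ∎

  ∑-*ʳ : ∀ {m} x (f : Fin m → Carrier) → ∑ f * x ≈ ∑ (λ i → f i * x)
  ∑-*ʳ x f = begin
    ∑ f * x             ≡⟨ ≡.cong (_* x) (∑≡sum f) ⟩
    sum f * x           ≈⟨ Sum.*-distribʳ-sum x f ⟩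
    sum (λ i → f i * x) ≡⟨ ∑≡sum (λ i → f i * x) ⟨
    ∑ (λ i → f i * x)   ∎

  ∑-comm : ∀ {m k} (f : Fin m → Fin k → Carrier) →
           ∑ (λ i → ∑ (λ j → f i j)) ≈ ∑ (λ j → ∑ (λ i → f i j))
  ∑-comm f = begin
    ∑ (λ i → ∑ (f i))                 ≈⟨ ∑-cong (λ i → reflexive (∑≡sum (f i))) ⟩
    ∑ (λ i → sum (f i))               ≡⟨ ∑≡sum (λ i → sum (f i)) ⟩
    sum (λ i → sum (f i))             ≈⟨ Sum.∑-comm f ⟩
    sum (λ j → sum (λ i → f i j))     ≡⟨ ∑≡sum (λ j → sum (λ i → f i j)) ⟨
    ∑ (λ j → sum (λ i → f i j))       ≈⟨ ∑-cong (λ j → reflexive (∑≡sum (λ i → f i j))) ⟨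
    ∑ (λ j → ∑ (λ i → f i j))         ∎

  ∑-permute : ∀ {m} (f : Fin m → Carrier) (π : Permutation m m) → ∑ f ≈ ∑ (f ∘ Inverse.to π)
  ∑-permute f π = viaSum f (f ∘ Inverse.to π) (Sum.sum-permute f π)

  ∑-neg : ∀ {m} (f : Fin m → Carrier) → - ∑ f ≈ ∑ (λ i → - f i)
  ∑-neg {zero}  f = -0#≈0#
  ∑-neg {suc m} f = trans (sym (-‿+-comm _ _)) (+-congˡ (∑-neg (f ∘ suc)))

  ∑-↑ : ∀ {k l} (g : Fin (k ℕ.+ l) → Carrier) → ∑ g ≈ ∑ (λ i → g (i ↑ˡ l)) + ∑ (λ j → g (k ↑ʳ j))
  ∑-↑ {zero}  g = sym (+-identityˡ _)
  ∑-↑ {suc k} g = trans (+-congˡ (∑-↑ {k} (g ∘ suc))) (sym (+-assoc _ _ _))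

  ∑-combine : ∀ {m k} (g : Fin (m ℕ.* k) → Carrier) → ∑ g ≈ ∑ (λ a → ∑ (λ b → g (combine {m} {k} a b)))
  ∑-combine {zero}      g = refl
  ∑-combine {suc m} {k} g = trans (∑-↑ {k} g) (+-congˡ (∑-combine {m} (λ i → g (k ↑ʳ i))))

  δ : ∀ {m} → Fin m → Fin m → Carrier
  δ i j = ind ⌊ i ≟ j ⌋

  ∑-δˡ : ∀ {m} (i : Fin m) (f : Fin m → Carrier) → ∑ (λ j → δ j i * f j) ≈ f i
  ∑-δˡ {suc m} zero    f = begin
    1# * f zero + ∑ (λ j → 0# * f (suc j)) ≈⟨ +-cong (*-identityˡ _) (∑-zero (λ j → zeroˡ (f (suc j)))) ⟩
    f zero + 0#                             ≈⟨ +-identityʳ _ ⟩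
    f zero                                  ∎
  ∑-δˡ {suc m} (suc i) f = begin
    0# * f zero + ∑ (λ j → δ (suc j) (suc i) * f (suc j))
      ≈⟨ +-cong (zeroˡ _) (∑-cong (λ j → reflexive (≡.cong (λ β → ind β * f (suc j)) (⌊suc≟suc⌋ j i)))) ⟩
    0# + ∑ (λ j → δ j i * f (suc j))
      ≈⟨ +-identityˡ _ ⟩
    ∑ (λ j → δ j i * f (suc j))
      ≈⟨ ∑-δˡ i (f ∘ suc) ⟩
    f (suc i) ∎

  ∑-δʳ : ∀ {m} (i : Fin m) (f : Fin m → Carrier) → ∑ (λ j → δ i j * f j) ≈ f i
  ∑-δʳ i f = trans (∑-cong (λ j → reflexive (≡.cong (λ β → ind β * f j) (⌊≟⌋-sym i j)))) (∑-δˡ i f)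

  ∑-const : ∀ m x → ∑ {m} (λ _ → x) ≈ m × x
  ∑-const m x = trans (reflexive (∑≡sum {m} (λ _ → x))) (Sum.sum-replicate m)


module Determinant (R : CommutativeRing ℓ₁ ℓ₂) where

  open CommutativeRing R hiding (zero)
  open MatrixDefs R
  open Summation R
  open import Algebra.Properties.Ring ring using (-‿distribˡ-*; -‿distribʳ-*; -‿involutive; -0#≈0#; +-inverseʳ-unique)
  open import Relation.Binary.Reasoning.Setoid setoid
  private module ⋆ = Algebra.Properties.CommutativeSemigroup *-commutativeSemigroup

  Matrix : ℕ → Set ℓ₁
  Matrix n = Fin n → Fin n → Carrier

  sign : ∀ {n} → Fin n → Carrier
  sign j = altSign (toℕ' j)

  minor : ∀ {n} → Matrix (suc n) → Fin (suc n) → Matrix n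
  minor M j a b = M (suc a) (punchIn j b)

  replaceRow : ∀ {m k} → (Fin m → Fin k → Carrier) → Fin m → (Fin k → Carrier) → Fin m → Fin k → Carrier
  replaceRow M i u = updateAt M i (const u)

  det-cong : ∀ {n} {M N : Matrix n} → (∀ i j → M i j ≈ N i j) → det M ≈ det N
  det-cong {zero}  e = refl
  det-cong {suc n} e = ∑-cong (λ j → *-congˡ {sign j} (*-cong (e zero j) (det-cong (λ a b → e (suc a) (punchIn j b)))))

  det-≗ : ∀ {n} {M N : Matrix n} → (∀ i → M i ≡ N i) → det M ≈ det N
  det-≗ e = det-cong (λ i j → reflexive (≡.cong-app (e i) j))

  replaceRow-cong : ∀ {m k} (M : Fin m → Fin k → Carrier) i {u v} → (∀ b → u b ≈ v b) →
                    ∀ a b → replaceRow M i u a b ≈ replaceRow M i v a b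
  replaceRow-cong M zero    e zero    b = e b
  replaceRow-cong M zero    e (suc a) b = refl
  replaceRow-cong M (suc i) e zero    b = refl
  replaceRow-cong M (suc i) e (suc a) b = replaceRow-cong (M ∘ suc) i e a b

  replaceRow-≗ : ∀ {m k} {M N : Fin m → Fin k → Carrier} → (∀ a → M a ≡ N a) →
                 ∀ i u a → replaceRow M i u a ≡ replaceRow N i u a
  replaceRow-≗ e zero    u zero    = ≡.refl
  replaceRow-≗ e zero    u (suc a) = e (suc a)
  replaceRow-≗ e (suc i) u zero    = e zero
  replaceRow-≗ e (suc i) u (suc a) = replaceRow-≗ (e ∘ suc) i u a

  minor-replaceRow : ∀ {n} (M : Matrix (suc n)) i u j a →
                     minor (replaceRow M (suc i) u) j a ≡ replaceRow (minor M j) i (u ∘ punchIn j) a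
  minor-replaceRow M i u j = map-updateAt {f = _∘ punchIn j} (λ _ → ≡.refl) (M ∘ suc) i

  private
    ∑-*-interchange : ∀ {m k} (x : Fin k → Carrier) (a : Fin m → Carrier) (f : Fin m → Fin k → Carrier) →
                      ∑ (λ j → a j * ∑ (λ l → x l * f j l)) ≈ ∑ (λ l → x l * ∑ (λ j → a j * f j l))
    ∑-*-interchange x a f = begin
      ∑ (λ j → a j * ∑ (λ l → x l * f j l))
        ≈⟨ ∑-cong (λ j → trans (∑-*ˡ (a j) (λ l → x l * f j l)) (∑-cong (λ l → ⋆.x∙yz≈y∙xz (a j) (x l) (f j l)))) ⟩
      ∑ (λ j → ∑ (λ l → x l * (a j * f j l)))
        ≈⟨ ∑-comm (λ j l → x l * (a j * f j l)) ⟩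
      ∑ (λ l → ∑ (λ j → x l * (a j * f j l)))
        ≈⟨ ∑-cong (λ l → ∑-*ˡ (x l) (λ j → a j * f j l)) ⟨
      ∑ (λ l → x l * ∑ (λ j → a j * f j l)) ∎

  det-linear : ∀ {n m} (M : Matrix n) i (x : Fin m → Carrier) (U : Fin m → Fin n → Carrier) →
               det (replaceRow M i (λ b → ∑ (λ l → x l * U l b))) ≈ ∑ (λ l → x l * det (replaceRow M i (U l)))
  det-linear {suc n} M zero x U = begin
    ∑ (λ j → sign j * (∑ (λ l → x l * U l j) * det (minor M j))) ≈⟨ ∑-cong expand ⟩
    ∑ (λ j → sign j * ∑ (λ l → x l * (U l j * det (minor M j)))) ≈⟨ ∑-*-interchange x sign (λ j l → U l j * det (minor M j)) ⟩
    ∑ (λ l → x l * ∑ (λ j → sign j * (U l j * det (minor M j)))) ∎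
    where
    expand : ∀ j → sign j * (∑ (λ l → x l * U l j) * det (minor M j)) ≈ sign j * ∑ (λ l → x l * (U l j * det (minor M j)))
    expand j = *-congˡ (trans (∑-*ʳ (det (minor M j)) (λ l → x l * U l j)) (∑-cong (λ l → *-assoc (x l) (U l j) (det (minor M j)))))
  det-linear {suc (suc n)} {m} M (suc i) x U = begin
    ∑ (λ j → sign j * (M zero j * det (minor (replaceRow M (suc i) row) j))) ≈⟨ ∑-cong expand ⟩
    ∑ (λ j → (sign j * M zero j) * ∑ (λ l → x l * D l j))                   ≈⟨ ∑-*-interchange x (λ j → sign j * M zero j) (λ j l → D l j) ⟩
    ∑ (λ l → x l * ∑ (λ j → (sign j * M zero j) * D l j))                   ≈⟨ ∑-cong (λ l → *-congˡ (∑-cong (regroup l))) ⟩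
    ∑ (λ l → x l * det (replaceRow M (suc i) (U l)))                         ∎
    where
    row : Fin (suc (suc n)) → Carrier
    row b = ∑ (λ l → x l * U l b)
    D : Fin m → Fin (suc (suc n)) → Carrier
    D l j = det (replaceRow (minor M j) i (U l ∘ punchIn j))
    expand : ∀ j → sign j * (M zero j * det (minor (replaceRow M (suc i) row) j)) ≈ (sign j * M zero j) * ∑ (λ l → x l * D l j)
    expand j = begin
      sign j * (M zero j * det (minor (replaceRow M (suc i) row) j))
        ≈⟨ *-congˡ (*-congˡ (det-≗ (minor-replaceRow M i row j))) ⟩
      sign j * (M zero j * det (replaceRow (minor M j) i (row ∘ punchIn j)))
        ≈⟨ *-congˡ (*-congˡ (det-linear (minor M j) i x (λ l → U l ∘ punchIn j))) ⟩
      sign j * (M zero j * ∑ (λ l → x l * D l j))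
        ≈⟨ *-assoc _ _ _ ⟨
      (sign j * M zero j) * ∑ (λ l → x l * D l j) ∎
    regroup : ∀ l j → (sign j * M zero j) * D l j ≈ sign j * (M zero j * det (minor (replaceRow M (suc i) (U l)) j))
    regroup l j = trans (*-assoc _ _ _) (*-congˡ (*-congˡ (det-≗ (≡.sym ∘ minor-replaceRow M i (U l) j))))

  det-additive : ∀ {n} (M : Matrix n) i (u v : Fin n → Carrier) →
                 det (replaceRow M i (λ b → u b + v b)) ≈ det (replaceRow M i u) + det (replaceRow M i v)
  det-additive M i u v = begin
    det (replaceRow M i (λ b → u b + v b))                         ≈⟨ det-cong (replaceRow-cong M i (λ b → sym (1u+[1v+0] b))) ⟩
    det (replaceRow M i (λ b → ∑ (λ l → 1# * pair l b)))          ≈⟨ det-linear M i (λ _ → 1#) pair ⟩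
    1# * det (replaceRow M i u) + (1# * det (replaceRow M i v) + 0#) ≈⟨ +-cong (*-identityˡ _) (trans (+-identityʳ _) (*-identityˡ _)) ⟩
    det (replaceRow M i u) + det (replaceRow M i v)                ∎
    where
    pair : Fin 2 → Fin _ → Carrier
    pair zero      = u
    pair (suc zero) = v
    1u+[1v+0] : ∀ b → 1# * u b + (1# * v b + 0#) ≈ u b + v b
    1u+[1v+0] b = +-cong (*-identityˡ _) (trans (+-identityʳ _) (*-identityˡ _))

  private
    infix 5 _≤ᵇ_
    _≤ᵇ_ : ∀ {a b} → Fin a → Fin b → Bool
    zero  ≤ᵇ _     = true
    suc _ ≤ᵇ zero  = false
    suc x ≤ᵇ suc y = x ≤ᵇ y

    not-suc≤ᵇ : ∀ {m} (x y : Fin m) → not (suc x ≤ᵇ y) ≡ y ≤ᵇ x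
    not-suc≤ᵇ x       zero    = ≡.refl
    not-suc≤ᵇ zero    (suc y) = ≡.refl
    not-suc≤ᵇ (suc x) (suc y) = not-suc≤ᵇ x y

    punchIn-below : ∀ {m} (j k : Fin m) → j ≤ᵇ k ≡ true → punchIn (suc k) j ≡ inject₁ j
    punchIn-below zero    k       _  = ≡.refl
    punchIn-below (suc j) (suc k) le = ≡.cong suc (punchIn-below j k le)

    punchIn-above : ∀ {m} (j k : Fin m) → j ≤ᵇ k ≡ true → punchIn (inject₁ j) k ≡ suc k
    punchIn-above zero    k       _  = ≡.refl
    punchIn-above (suc j) (suc k) le = ≡.cong suc (punchIn-above j k le)

    punchIn-punchIn : ∀ {m} (j k : Fin (suc m)) (b : Fin m) → j ≤ᵇ k ≡ true →
                      punchIn (suc k) (punchIn j b) ≡ punchIn (inject₁ j) (punchIn k b)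
    punchIn-punchIn zero    k       b       _  = ≡.refl
    punchIn-punchIn (suc j) (suc k) zero    _  = ≡.refl
    punchIn-punchIn (suc j) (suc k) (suc b) le = ≡.cong suc (punchIn-punchIn j k b le)

    toℕ'-inject₁ : ∀ {m} (j : Fin m) → toℕ' (inject₁ j) ≡ toℕ' j
    toℕ'-inject₁ zero    = ≡.refl
    toℕ'-inject₁ (suc j) = ≡.cong suc (toℕ'-inject₁ j)

    ind-split : ∀ β x → ind β * x + ind (not β) * x ≈ x
    ind-split true  x = trans (+-cong (*-identityˡ x) (zeroˡ x)) (+-identityʳ x)
    ind-split false x = trans (+-cong (zeroˡ x) (*-identityˡ x)) (+-identityˡ x)

    ∑-below-inject₁ : ∀ {m} (k : Fin m) (g : Fin (suc m) → Carrier) →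
                      ∑ (λ j → ind (j ≤ᵇ k) * g j) ≈ ∑ (λ j → ind (j ≤ᵇ k) * g (inject₁ j))
    ∑-below-inject₁ {suc m} zero    g =
      +-congˡ (trans (∑-zero (λ j → zeroˡ (g (suc j)))) (sym (∑-zero (λ j → zeroˡ (g (suc (inject₁ j)))))))
    ∑-below-inject₁ {suc m} (suc k) g = +-congˡ (∑-below-inject₁ k (g ∘ suc))

  -- Expanding along the first two rows, the term using columns (j, k + 1) with j ≤ k
  -- cancels the term using columns (k + 1, j): same entries, opposite signs.
  det-equal-first-rows : ∀ {n} (M : Matrix (suc (suc n))) → (∀ b → M (suc zero) b ≈ M zero b) → det M ≈ 0#
  det-equal-first-rows {n} M row₁≈row₀ = begin
    det M                                                            ≈⟨ ∑-cong expand ⟩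
    ∑ (λ j → ∑ (λ k → F j k))                                        ≈⟨ ∑-cong (λ j → ∑-cong (λ k → ind-split (j ≤ᵇ k) (F j k))) ⟨
    ∑ (λ j → ∑ (λ k → ind (j ≤ᵇ k) * F j k + ind (not (j ≤ᵇ k)) * F j k))
      ≈⟨ ∑-cong (λ j → ∑-+ (λ k → ind (j ≤ᵇ k) * F j k) (λ k → ind (not (j ≤ᵇ k)) * F j k)) ⟩
    ∑ (λ j → ∑ (λ k → ind (j ≤ᵇ k) * F j k) + ∑ (λ k → ind (not (j ≤ᵇ k)) * F j k))
      ≈⟨ ∑-+ (λ j → ∑ (λ k → ind (j ≤ᵇ k) * F j k)) (λ j → ∑ (λ k → ind (not (j ≤ᵇ k)) * F j k)) ⟩
    ∑ (λ j → ∑ (λ k → ind (j ≤ᵇ k) * F j k)) + ∑ (λ j → ∑ (λ k → ind (not (j ≤ᵇ k)) * F j k))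
      ≈⟨ +-cong ascending descending ⟩
    A + - A                                                          ≈⟨ -‿inverseʳ A ⟩
    0#                                                               ∎
    where
    D : Fin (suc (suc n)) → Fin (suc n) → Carrier
    D j k = det (λ a b → M (suc (suc a)) (punchIn j (punchIn k b)))
    F : Fin (suc (suc n)) → Fin (suc n) → Carrier
    F j k = (sign j * sign k) * ((M zero j * M zero (punchIn j k)) * D j k)
    A : Carrier
    A = ∑ (λ k → ∑ (λ j → ind (j ≤ᵇ k) * F (inject₁ j) k))

    expand : ∀ j → sign j * (M zero j * det (minor M j)) ≈ ∑ (λ k → F j k)
    expand j = begin
      sign j * (M zero j * ∑ (λ k → sign k * (M (suc zero) (punchIn j k) * D j k)))
        ≈⟨ *-congˡ (∑-*ˡ (M zero j) (λ k → sign k * (M (suc zero) (punchIn j k) * D j k))) ⟩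
      sign j * ∑ (λ k → M zero j * (sign k * (M (suc zero) (punchIn j k) * D j k)))
        ≈⟨ ∑-*ˡ (sign j) (λ k → M zero j * (sign k * (M (suc zero) (punchIn j k) * D j k))) ⟩
      ∑ (λ k → sign j * (M zero j * (sign k * (M (suc zero) (punchIn j k) * D j k))))
        ≈⟨ ∑-cong (λ k → trans (regroup (sign j) (M zero j) (sign k) _ (D j k)) (*-congˡ (*-congʳ (*-congˡ (row₁≈row₀ (punchIn j k)))))) ⟩
      ∑ (λ k → F j k) ∎
      where
      regroup : ∀ a b c d e → a * (b * (c * (d * e))) ≈ (a * c) * ((b * d) * e)
      regroup a b c d e = begin
        a * (b * (c * (d * e))) ≈⟨ *-congˡ (⋆.x∙yz≈y∙xz b c (d * e)) ⟩
        a * (c * (b * (d * e))) ≈⟨ *-assoc a c _ ⟨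
        (a * c) * (b * (d * e)) ≈⟨ *-congˡ (*-assoc b d e) ⟨
        (a * c) * ((b * d) * e) ∎

    ascending : ∑ (λ j → ∑ (λ k → ind (j ≤ᵇ k) * F j k)) ≈ A
    ascending = trans (∑-comm (λ j k → ind (j ≤ᵇ k) * F j k)) (∑-cong (λ k → ∑-below-inject₁ k (λ j → F j k)))

    pairing : ∀ (j k : Fin (suc n)) → ind (j ≤ᵇ k) * F (suc k) j ≈ - (ind (j ≤ᵇ k) * F (inject₁ j) k)
    pairing j k with j ≤ᵇ k in le
    ... | false = trans (zeroˡ _) (sym (trans (-‿cong (zeroˡ _)) -0#≈0#))
    ... | true  = begin
      1# * F (suc k) j
        ≈⟨ *-identityˡ _ ⟩
      (- sign k * sign j) * ((M zero (suc k) * M zero (punchIn (suc k) j)) * D (suc k) j)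
        ≈⟨ *-cong (sym (-‿distribˡ-* _ _)) (*-cong (*-congˡ (reflexive (≡.cong (M zero) (punchIn-below j k le))))
                                                    (det-cong (λ a b → reflexive (≡.cong (M (suc (suc a))) (punchIn-punchIn j k b le))))) ⟩
      - (sign k * sign j) * ((M zero (suc k) * M zero (inject₁ j)) * D (inject₁ j) k)
        ≈⟨ -‿distribˡ-* _ _ ⟨
      - ((sign k * sign j) * ((M zero (suc k) * M zero (inject₁ j)) * D (inject₁ j) k))
        ≈⟨ -‿cong (*-cong (trans (*-comm _ _) (*-congʳ (reflexive (≡.cong altSign (≡.sym (toℕ'-inject₁ j))))))
                          (*-congʳ (trans (*-comm _ _) (*-congˡ (reflexive (≡.cong (M zero) (≡.sym (punchIn-above j k le)))))))) ⟩
      - F (inject₁ j) k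
        ≈⟨ -‿cong (*-identityˡ _) ⟨
      - (1# * F (inject₁ j) k) ∎

    descending : ∑ (λ j → ∑ (λ k → ind (not (j ≤ᵇ k)) * F j k)) ≈ - A
    descending = begin
      ∑ (λ k → 0# * F zero k) + ∑ (λ j → ∑ (λ k → ind (not (suc j ≤ᵇ k)) * F (suc j) k))
        ≈⟨ +-cong (∑-zero (λ k → zeroˡ (F zero k))) (∑-cong (λ j → ∑-cong (λ k → reflexive (≡.cong (λ β → ind β * F (suc j) k) (not-suc≤ᵇ j k))))) ⟩
      0# + ∑ (λ j → ∑ (λ k → ind (k ≤ᵇ j) * F (suc j) k))
        ≈⟨ +-identityˡ _ ⟩
      ∑ (λ j → ∑ (λ k → ind (k ≤ᵇ j) * F (suc j) k))
        ≈⟨ ∑-cong (λ j → ∑-cong (λ k → pairing k j)) ⟩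
      ∑ (λ j → ∑ (λ k → - (ind (k ≤ᵇ j) * F (inject₁ k) j)))
        ≈⟨ ∑-cong (λ j → ∑-neg (λ k → ind (k ≤ᵇ j) * F (inject₁ k) j)) ⟨
      ∑ (λ j → - ∑ (λ k → ind (k ≤ᵇ j) * F (inject₁ k) j))
        ≈⟨ ∑-neg (λ j → ∑ (λ k → ind (k ≤ᵇ j) * F (inject₁ k) j)) ⟨
      - A ∎

  Alternating : ℕ → Set (ℓ₁ ⊔ ℓ₂)
  Alternating n = ∀ (M : Matrix n) {i k} → i ≢ k → (∀ b → M i b ≈ M k b) → det M ≈ 0#

  swapRows : ∀ {n} → Matrix n → Fin n → Fin n → Matrix n
  swapRows M i k = replaceRow (replaceRow M i (M k)) k (M i)

  det-swapRows : ∀ {n} → Alternating n → ∀ (M : Matrix n) {i k} → i ≢ k → det (swapRows M i k) ≈ - det M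
  det-swapRows {n} alt M {i} {k} i≢k = begin
    det (X (M k) (M i)) ≈⟨ +-inverseʳ-unique (det (X (M i) (M k))) (det (X (M k) (M i))) X-antisymmetric ⟩
    - det (X (M i) (M k)) ≈⟨ -‿cong (det-≗ X-id) ⟩
    - det M ∎
    where
    X : (Fin n → Carrier) → (Fin n → Carrier) → Matrix n
    X u v = replaceRow (replaceRow M i u) k v

    X-id : ∀ a → X (M i) (M k) a ≡ M a
    X-id a = ≡.trans (updateAt-id-local k (replaceRow M i (M i)) (≡.sym (updateAt-minimal k i M (i≢k ∘ ≡.sym))) a)
                     (updateAt-id-local i M ≡.refl a)

    X-diagonal : ∀ w → det (X w w) ≈ 0#
    X-diagonal w = alt (X w w) i≢k (λ b → reflexive (≡.cong-app rowᵢ≡rowₖ b))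
      where
      rowᵢ≡rowₖ : X w w i ≡ X w w k
      rowᵢ≡rowₖ = ≡.trans (updateAt-minimal i k _ i≢k) (≡.trans (updateAt-updates i M) (≡.sym (updateAt-updates k _)))

    X-additiveˡ : ∀ u v z → det (X (λ b → u b + v b) z) ≈ det (X u z) + det (X v z)
    X-additiveˡ u v z = begin
      det (X (λ b → u b + v b) z)                                        ≈⟨ det-≗ (updateAt-commutes k i (i≢k ∘ ≡.sym) M) ⟩
      det (replaceRow (replaceRow M k z) i (λ b → u b + v b))            ≈⟨ det-additive (replaceRow M k z) i u v ⟩
      det (replaceRow (replaceRow M k z) i u) + det (replaceRow (replaceRow M k z) i v)
        ≈⟨ +-cong (det-≗ (updateAt-commutes i k i≢k M)) (det-≗ (updateAt-commutes i k i≢k M)) ⟩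
      det (X u z) + det (X v z)                                          ∎

    X-antisymmetric : det (X (M i) (M k)) + det (X (M k) (M i)) ≈ 0#
    X-antisymmetric = begin
      det (X u v) + det (X v u)
        ≈⟨ +-cong (+-identityˡ _) (+-identityʳ _) ⟨
      (0# + det (X u v)) + (det (X v u) + 0#)
        ≈⟨ +-cong (+-congʳ (X-diagonal u)) (+-congˡ (X-diagonal v)) ⟨
      (det (X u u) + det (X u v)) + (det (X v u) + det (X v v))
        ≈⟨ +-cong (det-additive (replaceRow M i u) k u v) (det-additive (replaceRow M i v) k u v) ⟨
      det (X u w) + det (X v w)
        ≈⟨ X-additiveˡ u v w ⟨
      det (X w w)
        ≈⟨ X-diagonal w ⟩
      0# ∎
      where
      u v w : Fin n → Carrier
      u = M i
      v = M k
      w = λ b → u b + v b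

  private
    det-equal-rows-zero : ∀ {n} → Alternating n → ∀ (M : Matrix (suc n)) k → (∀ b → M zero b ≈ M (suc k) b) → det M ≈ 0#
    det-equal-rows-zero {suc n} alt M zero    row₀≈row₁ = det-equal-first-rows M (sym ∘ row₀≈row₁)
    -- Swapping rows 1 and k + 2 makes the first two rows equal and, by alternation in size
    -- n + 1, negates every minor along the first row.
    det-equal-rows-zero {suc n} alt M (suc k) row₀≈rowₖ = begin
      det M      ≈⟨ -‿involutive _ ⟨
      - - det M  ≈⟨ -‿cong det-M′ ⟨
      - det M′   ≈⟨ -‿cong (det-equal-first-rows M′ (sym ∘ row₀≈rowₖ)) ⟩
      - 0#       ≈⟨ -0#≈0# ⟩
      0#         ∎
      where
      M′ : Matrix (suc (suc n))
      M′ = swapRows M (suc zero) (suc (suc k))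
      minor-M′ : ∀ j a → minor M′ j a ≡ swapRows (minor M j) zero (suc k) a
      minor-M′ j a = ≡.trans (minor-replaceRow (replaceRow M (suc zero) (M (suc (suc k)))) (suc k) (M (suc zero)) j a)
                             (replaceRow-≗ (minor-replaceRow M zero (M (suc (suc k))) j) (suc k) _ a)
      det-M′ : det M′ ≈ - det M
      det-M′ = trans (∑-cong term) (sym (∑-neg (λ j → sign j * (M zero j * det (minor M j)))))
        where
        term : ∀ j → sign j * (M zero j * det (minor M′ j)) ≈ - (sign j * (M zero j * det (minor M j)))
        term j = begin
          sign j * (M zero j * det (minor M′ j))
            ≈⟨ *-congˡ (*-congˡ (trans (det-≗ (minor-M′ j)) (det-swapRows alt (minor M j) {zero} {suc k} (λ ())))) ⟩
          sign j * (M zero j * - det (minor M j))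
            ≈⟨ *-congˡ (-‿distribʳ-* _ _) ⟨
          sign j * - (M zero j * det (minor M j))
            ≈⟨ -‿distribʳ-* _ _ ⟨
          - (sign j * (M zero j * det (minor M j))) ∎

  det-alternating : ∀ n → Alternating n
  det-alternating (suc n) M {zero}  {zero}  0≢0 _ = contradiction ≡.refl 0≢0
  det-alternating (suc n) M {zero}  {suc k} _ rows≈ = det-equal-rows-zero (det-alternating n) M k rows≈
  det-alternating (suc n) M {suc i} {zero}  _ rows≈ = det-equal-rows-zero (det-alternating n) M i (sym ∘ rows≈)
  det-alternating (suc n) M {suc i} {suc k} i≢k rows≈ = ∑-zero term
    where
    term : ∀ j → sign j * (M zero j * det (minor M j)) ≈ 0#
    term j = begin
      sign j * (M zero j * det (minor M j)) ≈⟨ *-congˡ (*-congˡ (det-alternating n (minor M j) (i≢k ∘ ≡.cong suc) (rows≈ ∘ punchIn j))) ⟩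
      sign j * (M zero j * 0#)              ≈⟨ *-congˡ (zeroʳ _) ⟩
      sign j * 0#                           ≈⟨ zeroʳ _ ⟩
      0#                                    ∎

  adjugate : ∀ {n} → Matrix n → Matrix n
  adjugate E j i = det (replaceRow E i (δ j))

  adjugate-inverse : ∀ {n} (E : Matrix n) k i → ∑ (λ j → E k j * adjugate E j i) ≈ δ k i * det E
  adjugate-inverse {n} E k i = begin
    ∑ (λ j → E k j * det (replaceRow E i (δ j)))
      ≈⟨ det-linear E i (E k) δ ⟨
    det (replaceRow E i (λ b → ∑ (λ j → E k j * δ j b)))
      ≈⟨ det-cong (replaceRow-cong E i (λ b → trans (∑-cong (λ j → *-comm (E k j) (δ j b))) (∑-δˡ b (E k)))) ⟩
    det (replaceRow E i (E k))
      ≈⟨ rowₖ-at-i ⟩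
    δ k i * det E ∎
    where
    rowₖ-at-i : det (replaceRow E i (E k)) ≈ δ k i * det E
    rowₖ-at-i with k ≟ i
    ... | yes ≡.refl = trans (det-≗ (updateAt-id-local k E ≡.refl)) (sym (*-identityˡ _))
    ... | no k≢i     = trans (det-alternating n (replaceRow E i (E k)) (k≢i ∘ ≡.sym) rows≈) (sym (zeroˡ _))
      where
      rows≈ : ∀ b → replaceRow E i (E k) i b ≈ replaceRow E i (E k) k b
      rows≈ b = reflexive (≡.cong-app (≡.trans (updateAt-updates i E) (≡.sym (updateAt-minimal k i E k≢i))) b)

  det-δ : ∀ n → det {n} δ ≈ 1#
  det-δ zero    = refl
  det-δ (suc n) = begin
    1# * (1# * det (λ a b → I (suc a) (suc b))) + ∑ (λ j → sign (suc j) * (I zero (suc j) * det (minor I (suc j))))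
      ≈⟨ +-cong (trans (*-identityˡ _) (*-identityˡ _)) (∑-zero term) ⟩
    det (λ a b → I (suc a) (suc b)) + 0#  ≈⟨ +-identityʳ _ ⟩
    det (λ a b → I (suc a) (suc b))       ≈⟨ det-cong {n} (λ a b → reflexive (≡.cong ind (⌊suc≟suc⌋ a b))) ⟩
    det {n} δ                             ≈⟨ det-δ n ⟩
    1#                                    ∎
    where
    I : Matrix (suc n)
    I = δ
    term : ∀ j → sign (suc j) * (I zero (suc j) * det (minor I (suc j))) ≈ 0#
    term j = trans (*-congˡ (zeroˡ _)) (zeroʳ _)

  module Jacobi (D : Carrier → Carrier) (D-cong : ∀ {x y} → x ≈ y → D x ≈ D y)
                (D-+ : ∀ x y → D (x + y) ≈ D x + D y) (D-* : ∀ x y → D (x * y) ≈ D x * y + x * D y) where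

    open import Algebra.Properties.Ring ring using (x+x≈x⇒x≈0)

    private
      D-0# : D 0# ≈ 0#
      D-0# = x+x≈x⇒x≈0 _ (sym (trans (D-cong (sym (+-identityʳ 0#))) (D-+ 0# 0#)))

      D-1# : D 1# ≈ 0#
      D-1# = x+x≈x⇒x≈0 _ (sym (trans (D-cong (sym (*-identityʳ 1#))) (trans (D-* 1# 1#) (+-cong (*-identityʳ _) (*-identityˡ _)))))

      D-‿ : ∀ x → D (- x) ≈ - D x
      D-‿ x = +-inverseʳ-unique (D x) (D (- x)) (trans (sym (D-+ x (- x))) (trans (D-cong (-‿inverseʳ x)) D-0#))

      D-sign : ∀ {m} (j : Fin m) x → D (sign j * x) ≈ sign j * D x
      D-sign j x = trans (D-* _ _) (trans (+-congʳ (trans (*-congʳ (D-altSign (toℕ' j))) (zeroˡ _))) (+-identityˡ _))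
        where
        D-altSign : ∀ k → D (altSign k) ≈ 0#
        D-altSign zero    = D-1#
        D-altSign (suc k) = trans (D-‿ _) (trans (-‿cong (D-altSign k)) -0#≈0#)

      D-∑ : ∀ {m} (f : Fin m → Carrier) → D (∑ f) ≈ ∑ (λ i → D (f i))
      D-∑ {zero}  f = D-0#
      D-∑ {suc m} f = trans (D-+ _ _) (+-congˡ (D-∑ (f ∘ suc)))

    jacobi : ∀ {n} (E : Matrix n) → D (det E) ≈ ∑ (λ i → det (replaceRow E i (D ∘ E i)))
    jacobi {zero}  E = D-1#
    jacobi {suc n} E = begin
      D (∑ (λ j → sign j * (E zero j * det (minor E j))))
        ≈⟨ D-∑ (λ j → sign j * (E zero j * det (minor E j))) ⟩
      ∑ (λ j → D (sign j * (E zero j * det (minor E j))))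
        ≈⟨ ∑-cong leibniz ⟩
      ∑ (λ j → sign j * (D (E zero j) * det (minor E j)) + sign j * (E zero j * D (det (minor E j))))
        ≈⟨ ∑-+ (λ j → sign j * (D (E zero j) * det (minor E j))) (λ j → sign j * (E zero j * D (det (minor E j)))) ⟩
      det (replaceRow E zero (D ∘ E zero)) + ∑ (λ j → sign j * (E zero j * D (det (minor E j))))
        ≈⟨ +-congˡ lower-rows ⟩
      det (replaceRow E zero (D ∘ E zero)) + ∑ (λ i → det (replaceRow E (suc i) (D ∘ E (suc i)))) ∎
      where
      leibniz : ∀ j → D (sign j * (E zero j * det (minor E j))) ≈
                      sign j * (D (E zero j) * det (minor E j)) + sign j * (E zero j * D (det (minor E j)))
      leibniz j = trans (D-sign j _) (trans (*-congˡ (D-* (E zero j) (det (minor E j)))) (distribˡ (sign j) _ _))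
      T : Fin (suc n) → Fin n → Carrier
      T j i = sign j * (E zero j * det (replaceRow (minor E j) i (D ∘ minor E j i)))
      expand : ∀ j → sign j * (E zero j * D (det (minor E j))) ≈ ∑ (λ i → T j i)
      expand j = begin
        sign j * (E zero j * D (det (minor E j)))
          ≈⟨ *-congˡ (*-congˡ (jacobi (minor E j))) ⟩
        sign j * (E zero j * ∑ (λ i → det (replaceRow (minor E j) i (D ∘ minor E j i))))
          ≈⟨ *-congˡ (∑-*ˡ (E zero j) (λ i → det (replaceRow (minor E j) i (D ∘ minor E j i)))) ⟩
        sign j * ∑ (λ i → E zero j * det (replaceRow (minor E j) i (D ∘ minor E j i)))
          ≈⟨ ∑-*ˡ (sign j) (λ i → E zero j * det (replaceRow (minor E j) i (D ∘ minor E j i))) ⟩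
        ∑ (λ i → T j i) ∎
      lower-rows : ∑ (λ j → sign j * (E zero j * D (det (minor E j)))) ≈ ∑ (λ i → det (replaceRow E (suc i) (D ∘ E (suc i))))
      lower-rows = begin
        ∑ (λ j → sign j * (E zero j * D (det (minor E j))))
          ≈⟨ ∑-cong expand ⟩
        ∑ (λ j → ∑ (λ i → T j i))
          ≈⟨ ∑-comm T ⟩
        ∑ (λ i → ∑ (λ j → T j i))
          ≈⟨ ∑-cong (λ i → ∑-cong (λ j → *-congˡ {sign j} (*-congˡ {E zero j} (det-≗ (≡.sym ∘ minor-replaceRow E i (D ∘ E (suc i)) j))))) ⟩
        ∑ (λ i → det (replaceRow E (suc i) (D ∘ E (suc i)))) ∎


module MatrixAlgebra (R : CommutativeRing ℓ₁ ℓ₂) where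

  open CommutativeRing R hiding (zero)
  open MatrixDefs R
  open Summation R
  open Determinant R using (Matrix)
  open import Relation.Binary.Reasoning.Setoid setoid
  private module ⋆ = Algebra.Properties.CommutativeSemigroup *-commutativeSemigroup

  infixl 7 _⊗_
  _⊗_ : ∀ {n} → Matrix n → Matrix n → Matrix n
  (A ⊗ B) i j = ∑ (λ k → A i k * B k j)

  infixr 8 _^_
  _^_ : ∀ {n} → Matrix n → ℕ → Matrix n
  A ^ zero  = δ
  A ^ suc k = A ^ k ⊗ A

  trace : ∀ {n} → Matrix n → Carrier
  trace A = ∑ (λ i → A i i)

  trace-^1⊗ : ∀ {n} (A B : Matrix n) → trace (A ^ 1 ⊗ B) ≈ trace (A ⊗ B)
  trace-^1⊗ A B = ∑-cong (λ k → ∑-cong (λ l → *-congʳ (∑-δʳ k (λ m → A m l))))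

  trace-⊗-recurrence : ∀ {n} (P A Y Z : Matrix n) γ → (∀ l k → Y l k ≈ (A ⊗ Z) l k + δ l k * γ) →
                       trace (P ⊗ Y) ≈ trace (P ⊗ A ⊗ Z) + γ * trace P
  trace-⊗-recurrence P A Y Z γ Y≈ = begin
    ∑ (λ k → ∑ (λ l → P k l * Y l k))
      ≈⟨ ∑-cong (λ k → ∑-cong (λ l → trans (*-congˡ (Y≈ l k)) (distribˡ (P k l) _ _))) ⟩
    ∑ (λ k → ∑ (λ l → P k l * (A ⊗ Z) l k + P k l * (δ l k * γ)))
      ≈⟨ ∑-cong (λ k → ∑-+ (λ l → P k l * (A ⊗ Z) l k) (λ l → P k l * (δ l k * γ))) ⟩
    ∑ (λ k → ∑ (λ l → P k l * (A ⊗ Z) l k) + ∑ (λ l → P k l * (δ l k * γ)))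
      ≈⟨ ∑-+ (λ k → ∑ (λ l → P k l * (A ⊗ Z) l k)) (λ k → ∑ (λ l → P k l * (δ l k * γ))) ⟩
    ∑ (λ k → ∑ (λ l → P k l * (A ⊗ Z) l k)) + ∑ (λ k → ∑ (λ l → P k l * (δ l k * γ)))
      ≈⟨ +-cong (∑-cong reassociate) scalar ⟩
    trace (P ⊗ A ⊗ Z) + γ * trace P ∎
    where
    reassociate : ∀ k → ∑ (λ l → P k l * (A ⊗ Z) l k) ≈ (P ⊗ A ⊗ Z) k k
    reassociate k = begin
      ∑ (λ l → P k l * ∑ (λ m → A l m * Z m k))   ≈⟨ ∑-cong (λ l → ∑-*ˡ (P k l) (λ m → A l m * Z m k)) ⟩
      ∑ (λ l → ∑ (λ m → P k l * (A l m * Z m k))) ≈⟨ ∑-comm (λ l m → P k l * (A l m * Z m k)) ⟩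
      ∑ (λ m → ∑ (λ l → P k l * (A l m * Z m k))) ≈⟨ ∑-cong (λ m → ∑-cong (λ l → *-assoc (P k l) (A l m) (Z m k))) ⟨
      ∑ (λ m → ∑ (λ l → (P k l * A l m) * Z m k)) ≈⟨ ∑-cong (λ m → ∑-*ʳ (Z m k) (λ l → P k l * A l m)) ⟨
      ∑ (λ m → (P ⊗ A) k m * Z m k)               ∎
    scalar : ∑ (λ k → ∑ (λ l → P k l * (δ l k * γ))) ≈ γ * trace P
    scalar = begin
      ∑ (λ k → ∑ (λ l → P k l * (δ l k * γ))) ≈⟨ ∑-cong (λ k → trans (∑-cong (λ l → ⋆.x∙yz≈y∙xz (P k l) (δ l k) γ)) (∑-δˡ k (λ l → P k l * γ))) ⟩
      ∑ (λ k → P k k * γ)                     ≈⟨ ∑-*ʳ γ (λ k → P k k) ⟨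
      trace P * γ                             ≈⟨ *-comm (trace P) γ ⟩
      γ * trace P                             ∎

record RingHom (A : CommutativeRing ℓ₁ ℓ₂) (B : CommutativeRing ℓ₃ ℓ₄) : Set (ℓ₁ ⊔ ℓ₂ ⊔ ℓ₃ ⊔ ℓ₄) where
  private
    module A = CommutativeRing A
    module B = CommutativeRing B
  field
    ⟦_⟧     : A.Carrier → B.Carrier
    cong    : ∀ {x y} → x A.≈ y → ⟦ x ⟧ B.≈ ⟦ y ⟧
    +-homo  : ∀ x y → ⟦ x A.+ y ⟧ B.≈ ⟦ x ⟧ B.+ ⟦ y ⟧
    *-homo  : ∀ x y → ⟦ x A.* y ⟧ B.≈ ⟦ x ⟧ B.* ⟦ y ⟧
    1#-homo : ⟦ A.1# ⟧ B.≈ B.1#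

module RingHomProperties {A : CommutativeRing ℓ₁ ℓ₂} {B : CommutativeRing ℓ₃ ℓ₄} (h : RingHom A B) where

  private
    module A = CommutativeRing A
    module MA = MatrixDefs A
  open RingHom h
  open CommutativeRing B hiding (zero)
  open MatrixDefs B
  open Summation B
  open import Algebra.Properties.Ring ring using (x+x≈x⇒x≈0; +-inverseʳ-unique)

  0#-homo : ⟦ A.0# ⟧ ≈ 0#
  0#-homo = x+x≈x⇒x≈0 _ (sym (trans (cong (A.sym (A.+-identityʳ A.0#))) (+-homo A.0# A.0#)))

  -‿homo : ∀ x → ⟦ A.- x ⟧ ≈ - ⟦ x ⟧
  -‿homo x = +-inverseʳ-unique ⟦ x ⟧ ⟦ A.- x ⟧ (trans (sym (+-homo x (A.- x))) (trans (cong (A.-‿inverseʳ x)) 0#-homo))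

  ∑-homo : ∀ {m} (f : Fin m → A.Carrier) → ⟦ MA.∑ f ⟧ ≈ ∑ (⟦_⟧ ∘ f)
  ∑-homo {zero}  f = 0#-homo
  ∑-homo {suc m} f = trans (+-homo _ _) (+-congˡ (∑-homo (f ∘ suc)))

  ind-homo : ∀ β → ⟦ MA.ind β ⟧ ≈ ind β
  ind-homo true  = 1#-homo
  ind-homo false = 0#-homo

  sign-homo : ∀ {m} (j : Fin m) → ⟦ MA.altSign (MA.toℕ' j) ⟧ ≈ altSign (toℕ' j)
  sign-homo zero    = 1#-homo
  sign-homo (suc j) = trans (-‿homo _) (-‿cong (sign-homo j))

  det-homo : ∀ {n} (M : Fin n → Fin n → A.Carrier) → ⟦ MA.det M ⟧ ≈ det (λ i j → ⟦ M i j ⟧)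
  det-homo {zero}  M = 1#-homo
  det-homo {suc n} M = trans (∑-homo (λ j → MA.altSign (MA.toℕ' j) A.* (M zero j A.* MA.det (λ a b → M (suc a) (punchIn j b)))))
                             (∑-cong term)
    where
    term : ∀ j → ⟦ MA.altSign (MA.toℕ' j) A.* (M zero j A.* MA.det (λ a b → M (suc a) (punchIn j b))) ⟧ ≈
                 altSign (toℕ' j) * (⟦ M zero j ⟧ * det (λ a b → ⟦ M (suc a) (punchIn j b) ⟧))
    term j = trans (*-homo _ _) (*-cong (sign-homo j) (trans (*-homo _ _) (*-congˡ (det-homo (λ a b → M (suc a) (punchIn j b))))))

  charMat-homo : ∀ {n} (W : Fin n → Fin n → A.Carrier) t i j → ⟦ MA.charMat W t i j ⟧ ≈ charMat (λ a b → ⟦ W a b ⟧) ⟦ t ⟧ i j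
  charMat-homo W t i j = trans (+-homo _ _) (+-cong (trans (*-homo _ _) (*-congˡ (ind-homo ⌊ i ≟ j ⌋))) (-‿homo (W i j)))

  Wmat-homo : ∀ {n p} (G : Graph n) (cls : Fin n → Fin p) x₀ x i j →
              ⟦ MA.Wmat G cls x₀ x i j ⟧ ≈ Wmat G cls ⟦ x₀ ⟧ (λ a b → ⟦ x a b ⟧) i j
  Wmat-homo G cls x₀ x i j =
    trans (+-homo _ _) (+-cong (trans (*-homo _ _) (*-congˡ (ind-homo (adj G i j))))
                               (trans (∑-homo (λ c → MA.∑ (λ d → x c d A.* MA.Jmat cls c d i j))) (∑-cong outer)))
    where
    outer : ∀ c → ⟦ MA.∑ (λ d → x c d A.* MA.Jmat cls c d i j) ⟧ ≈ ∑ (λ d → ⟦ x c d ⟧ * Jmat cls c d i j)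
    outer c = trans (∑-homo (λ d → x c d A.* MA.Jmat cls c d i j)) (∑-cong entry)
      where
      entry : ∀ d → ⟦ x c d A.* MA.Jmat cls c d i j ⟧ ≈ ⟦ x c d ⟧ * Jmat cls c d i j
      entry d = trans (*-homo _ _) (*-congˡ (trans (*-homo _ _) (*-cong (ind-homo ⌊ cls i ≟ c ⌋) (ind-homo ⌊ cls j ≟ d ⌋))))


TorsionFree : CommutativeRing ℓ₁ ℓ₂ → Set (ℓ₁ ⊔ ℓ₂)
TorsionFree R = ∀ n x → suc n × x ≈ 0# → x ≈ 0#
  where
  open CommutativeRing R
  open Algebra.Properties.Monoid.Mult +-monoid using (_×_)

module Polynomial (R : CommutativeRing ℓ₁ ℓ₂) where

  open CommutativeRing R hiding (zero)
  open MatrixDefs R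
  open Summation R
  open import Relation.Binary.Reasoning.Setoid setoid
  open import Algebra.Properties.Ring ring using (-0#≈0#)

  -- Coefficient lists, constant term first; equality is coefficientwise, so trailing zeros do not matter.
  Poly : Set ℓ₁
  Poly = List Carrier

  coeff : Poly → ℕ → Carrier
  coeff []      _       = 0#
  coeff (a ∷ p) zero    = a
  coeff (a ∷ p) (suc k) = coeff p k

  infix 4 _≈ₚ_
  record _≈ₚ_ (p q : Poly) : Set ℓ₂ where
    constructor mk≈ₚ
    field coeff-≈ : ∀ k → coeff p k ≈ coeff q k
  open _≈ₚ_ public

  infixl 6 _+ₚ_
  infixl 7 _*ₚ_ _·ₚ_
  infix  8 -ₚ_

  _+ₚ_ : Poly → Poly → Poly
  []      +ₚ q       = q
  (a ∷ p) +ₚ []      = a ∷ p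
  (a ∷ p) +ₚ (b ∷ q) = a + b ∷ p +ₚ q

  -ₚ_ : Poly → Poly
  -ₚ []      = []
  -ₚ (a ∷ p) = - a ∷ -ₚ p

  _·ₚ_ : Carrier → Poly → Poly
  x ·ₚ []      = []
  x ·ₚ (a ∷ p) = x * a ∷ x ·ₚ p

  _*ₚ_ : Poly → Poly → Poly
  []      *ₚ q = []
  (a ∷ p) *ₚ q = a ·ₚ q +ₚ (0# ∷ p *ₚ q)

  constant : Carrier → Poly
  constant a = a ∷ []

  X : Poly
  X = 0# ∷ 1# ∷ []

  coeff-+ : ∀ p q k → coeff (p +ₚ q) k ≈ coeff p k + coeff q k
  coeff-+ []      q       k       = sym (+-identityˡ _)
  coeff-+ (a ∷ p) []      k       = sym (+-identityʳ _)
  coeff-+ (a ∷ p) (b ∷ q) zero    = refl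
  coeff-+ (a ∷ p) (b ∷ q) (suc k) = coeff-+ p q k

  coeff-‿ : ∀ p k → coeff (-ₚ p) k ≈ - coeff p k
  coeff-‿ []      k       = sym -0#≈0#
  coeff-‿ (a ∷ p) zero    = refl
  coeff-‿ (a ∷ p) (suc k) = coeff-‿ p k

  coeff-· : ∀ x p k → coeff (x ·ₚ p) k ≈ x * coeff p k
  coeff-· x []      k       = sym (zeroʳ x)
  coeff-· x (a ∷ p) zero    = refl
  coeff-· x (a ∷ p) (suc k) = coeff-· x p k

  coeff-* : ∀ p q k → coeff (p *ₚ q) k ≈ ∑ {suc k} (λ i → coeff p (toℕ i) * coeff q (k ∸ toℕ i))
  coeff-* []      q k       = sym (∑-zero {suc k} (λ i → zeroˡ (coeff q (k ∸ toℕ i))))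
  coeff-* (a ∷ p) q zero    = trans (coeff-+ (a ·ₚ q) (0# ∷ p *ₚ q) zero) (+-congʳ (coeff-· a q zero))
  coeff-* (a ∷ p) q (suc k) = trans (coeff-+ (a ·ₚ q) (0# ∷ p *ₚ q) (suc k)) (+-cong (coeff-· a q (suc k)) (coeff-* p q k))

  ≈ₚ-refl : ∀ {p} → p ≈ₚ p
  ≈ₚ-refl = mk≈ₚ (λ _ → refl)

  ≈ₚ-sym : ∀ {p q} → p ≈ₚ q → q ≈ₚ p
  ≈ₚ-sym e = mk≈ₚ (sym ∘ coeff-≈ e)

  ≈ₚ-trans : ∀ {p q r} → p ≈ₚ q → q ≈ₚ r → p ≈ₚ r
  ≈ₚ-trans e f = mk≈ₚ (λ k → trans (coeff-≈ e k) (coeff-≈ f k))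

  ∷-cong : ∀ {a b p q} → a ≈ b → p ≈ₚ q → a ∷ p ≈ₚ b ∷ q
  ∷-cong a≈b e = mk≈ₚ λ { zero → a≈b ; (suc k) → coeff-≈ e k }

  +ₚ-cong : ∀ {p p′ q q′} → p ≈ₚ p′ → q ≈ₚ q′ → p +ₚ q ≈ₚ p′ +ₚ q′
  +ₚ-cong {p} {p′} {q} {q′} e f = mk≈ₚ λ k → begin
    coeff (p +ₚ q) k         ≈⟨ coeff-+ p q k ⟩
    coeff p k + coeff q k    ≈⟨ +-cong (coeff-≈ e k) (coeff-≈ f k) ⟩
    coeff p′ k + coeff q′ k  ≈⟨ coeff-+ p′ q′ k ⟨
    coeff (p′ +ₚ q′) k       ∎

  -ₚ-cong : ∀ {p q} → p ≈ₚ q → -ₚ p ≈ₚ -ₚ q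
  -ₚ-cong {p} {q} e = mk≈ₚ λ k → trans (coeff-‿ p k) (trans (-‿cong (coeff-≈ e k)) (sym (coeff-‿ q k)))


  *ₚ-cong : ∀ {p p′ q q′} → p ≈ₚ p′ → q ≈ₚ q′ → p *ₚ q ≈ₚ p′ *ₚ q′
  *ₚ-cong {p} {p′} {q} {q′} e f = mk≈ₚ λ k → begin
    coeff (p *ₚ q) k                                          ≈⟨ coeff-* p q k ⟩
    ∑ {suc k} (λ i → coeff p (toℕ i) * coeff q (k ∸ toℕ i))   ≈⟨ ∑-cong {suc k} (λ i → *-cong (coeff-≈ e (toℕ i)) (coeff-≈ f (k ∸ toℕ i))) ⟩
    ∑ {suc k} (λ i → coeff p′ (toℕ i) * coeff q′ (k ∸ toℕ i)) ≈⟨ coeff-* p′ q′ k ⟨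
    coeff (p′ *ₚ q′) k                                        ∎

  +ₚ-assoc : ∀ p q r → (p +ₚ q) +ₚ r ≈ₚ p +ₚ (q +ₚ r)
  +ₚ-assoc p q r = mk≈ₚ λ k → begin
    coeff ((p +ₚ q) +ₚ r) k               ≈⟨ trans (coeff-+ (p +ₚ q) r k) (+-congʳ (coeff-+ p q k)) ⟩
    (coeff p k + coeff q k) + coeff r k   ≈⟨ +-assoc _ _ _ ⟩
    coeff p k + (coeff q k + coeff r k)   ≈⟨ trans (coeff-+ p (q +ₚ r) k) (+-congˡ (coeff-+ q r k)) ⟨
    coeff (p +ₚ (q +ₚ r)) k               ∎

  +ₚ-comm : ∀ p q → p +ₚ q ≈ₚ q +ₚ p
  +ₚ-comm p q = mk≈ₚ λ k → trans (coeff-+ p q k) (trans (+-comm _ _) (sym (coeff-+ q p k)))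

  +ₚ-identityʳ : ∀ p → p +ₚ [] ≈ₚ p
  +ₚ-identityʳ p = mk≈ₚ λ k → trans (coeff-+ p [] k) (+-identityʳ _)

  -ₚ-inverseˡ : ∀ p → -ₚ p +ₚ p ≈ₚ []
  -ₚ-inverseˡ p = mk≈ₚ λ k → trans (coeff-+ (-ₚ p) p k) (trans (+-congʳ (coeff-‿ p k)) (-‿inverseˡ _))

  -ₚ-inverseʳ : ∀ p → p +ₚ -ₚ p ≈ₚ []
  -ₚ-inverseʳ p = mk≈ₚ λ k → trans (coeff-+ p (-ₚ p) k) (trans (+-congˡ (coeff-‿ p k)) (-‿inverseʳ _))

  *ₚ-distribʳ : ∀ r p q → (p +ₚ q) *ₚ r ≈ₚ p *ₚ r +ₚ q *ₚ r
  *ₚ-distribʳ r p q = mk≈ₚ distrib-at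
    where
    distrib-at : ∀ k → coeff ((p +ₚ q) *ₚ r) k ≈ coeff (p *ₚ r +ₚ q *ₚ r) k
    distrib-at k = begin
      coeff ((p +ₚ q) *ₚ r) k                   ≈⟨ coeff-* (p +ₚ q) r k ⟩
      ∑ (λ i → coeff (p +ₚ q) (toℕ i) * r′ i)   ≈⟨ ∑-cong {suc k} (λ i → trans (*-congʳ (coeff-+ p q (toℕ i))) (distribʳ (r′ i) (p′ i) (q′ i))) ⟩
      ∑ (λ i → p′ i * r′ i + q′ i * r′ i)       ≈⟨ ∑-+ {suc k} (λ i → p′ i * r′ i) (λ i → q′ i * r′ i) ⟩
      ∑ (λ i → p′ i * r′ i) + ∑ (λ i → q′ i * r′ i) ≈⟨ +-cong (coeff-* p r k) (coeff-* q r k) ⟨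
      coeff (p *ₚ r) k + coeff (q *ₚ r) k       ≈⟨ coeff-+ (p *ₚ r) (q *ₚ r) k ⟨
      coeff (p *ₚ r +ₚ q *ₚ r) k                ∎
      where
      p′ q′ r′ : Fin (suc k) → Carrier
      p′ i = coeff p (toℕ i)
      q′ i = coeff q (toℕ i)
      r′ i = coeff r (k ∸ toℕ i)

  ·ₚ-*ₚ : ∀ x q r → x ·ₚ q *ₚ r ≈ₚ x ·ₚ (q *ₚ r)
  ·ₚ-*ₚ x q r = mk≈ₚ λ k → begin
    coeff (x ·ₚ q *ₚ r) k
      ≈⟨ coeff-* (x ·ₚ q) r k ⟩
    ∑ {suc k} (λ i → coeff (x ·ₚ q) (toℕ i) * coeff r (k ∸ toℕ i))
      ≈⟨ ∑-cong {suc k} (λ i → trans (*-congʳ (coeff-· x q (toℕ i))) (*-assoc x (coeff q (toℕ i)) (coeff r (k ∸ toℕ i)))) ⟩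
    ∑ {suc k} (λ i → x * (coeff q (toℕ i) * coeff r (k ∸ toℕ i)))
      ≈⟨ ∑-*ˡ {suc k} x (λ i → coeff q (toℕ i) * coeff r (k ∸ toℕ i)) ⟨
    x * ∑ {suc k} (λ i → coeff q (toℕ i) * coeff r (k ∸ toℕ i))
      ≈⟨ *-congˡ (coeff-* q r k) ⟨
    x * coeff (q *ₚ r) k
      ≈⟨ coeff-· x (q *ₚ r) k ⟨
    coeff (x ·ₚ (q *ₚ r)) k ∎

  0∷-*ₚ : ∀ q r → (0# ∷ q) *ₚ r ≈ₚ 0# ∷ q *ₚ r
  0∷-*ₚ q r = mk≈ₚ λ k →
    trans (coeff-+ (0# ·ₚ r) (0# ∷ q *ₚ r) k) (trans (+-congʳ (trans (coeff-· 0# r k) (zeroˡ _))) (+-identityˡ _))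

  *ₚ-assoc : ∀ p q r → (p *ₚ q) *ₚ r ≈ₚ p *ₚ (q *ₚ r)
  *ₚ-assoc []      q r = ≈ₚ-refl
  *ₚ-assoc (a ∷ p) q r =
    ≈ₚ-trans (*ₚ-distribʳ r (a ·ₚ q) (0# ∷ p *ₚ q))
             (+ₚ-cong (·ₚ-*ₚ a q r) (≈ₚ-trans (0∷-*ₚ (p *ₚ q) r) (∷-cong refl (*ₚ-assoc p q r))))

  coeff-constant* : ∀ a p k → coeff (constant a *ₚ p) k ≈ a * coeff p k
  coeff-constant* a p k = trans (coeff-+ (a ·ₚ p) (0# ∷ []) k) (trans (+-cong (coeff-· a p k) (coeff-0∷[] k)) (+-identityʳ _))
    where
    coeff-0∷[] : ∀ k → coeff (0# ∷ []) k ≈ 0#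
    coeff-0∷[] zero    = refl
    coeff-0∷[] (suc k) = refl

  *ₚ-identityˡ : ∀ p → constant 1# *ₚ p ≈ₚ p
  *ₚ-identityˡ p = mk≈ₚ λ k → trans (coeff-constant* 1# p k) (*-identityˡ _)

  private
    coeff-*ₚ[] : ∀ q k → coeff (q *ₚ []) k ≈ 0#
    coeff-*ₚ[] []      k       = refl
    coeff-*ₚ[] (b ∷ q) zero    = refl
    coeff-*ₚ[] (b ∷ q) (suc k) = coeff-*ₚ[] q k

    module ⊕ = Algebra.Properties.CommutativeSemigroup +-commutativeSemigroup

    *ₚ-∷ : ∀ q a p → q *ₚ (a ∷ p) ≈ₚ a ·ₚ q +ₚ (0# ∷ q *ₚ p)
    *ₚ-∷ []      a p = mk≈ₚ λ { zero → refl ; (suc k) → refl }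
    *ₚ-∷ (b ∷ q) a p = mk≈ₚ λ
      { zero    → trans (+-identityʳ _) (trans (*-comm _ _) (sym (+-identityʳ _)))
      ; (suc k) → begin
          coeff (b ·ₚ p +ₚ q *ₚ (a ∷ p)) k
            ≈⟨ coeff-+ (b ·ₚ p) (q *ₚ (a ∷ p)) k ⟩
          coeff (b ·ₚ p) k + coeff (q *ₚ (a ∷ p)) k
            ≈⟨ +-congˡ (trans (coeff-≈ (*ₚ-∷ q a p) k) (coeff-+ (a ·ₚ q) (0# ∷ q *ₚ p) k)) ⟩
          coeff (b ·ₚ p) k + (coeff (a ·ₚ q) k + coeff (0# ∷ q *ₚ p) k)
            ≈⟨ ⊕.x∙yz≈y∙xz _ _ _ ⟩
          coeff (a ·ₚ q) k + (coeff (b ·ₚ p) k + coeff (0# ∷ q *ₚ p) k)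
            ≈⟨ +-congˡ (coeff-+ (b ·ₚ p) (0# ∷ q *ₚ p) k) ⟨
          coeff (a ·ₚ q) k + coeff (b ·ₚ p +ₚ (0# ∷ q *ₚ p)) k
            ≈⟨ coeff-+ (a ·ₚ q) (b ·ₚ p +ₚ (0# ∷ q *ₚ p)) k ⟨
          coeff (a ·ₚ q +ₚ (b ·ₚ p +ₚ (0# ∷ q *ₚ p))) k                     ∎ }

  *ₚ-comm : ∀ p q → p *ₚ q ≈ₚ q *ₚ p
  *ₚ-comm []      q = mk≈ₚ (sym ∘ coeff-*ₚ[] q)
  *ₚ-comm (a ∷ p) q = ≈ₚ-trans (+ₚ-cong (≈ₚ-refl {a ·ₚ q}) (∷-cong refl (*ₚ-comm p q))) (≈ₚ-sym (*ₚ-∷ q a p))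

  *ₚ-distribˡ : ∀ r p q → r *ₚ (p +ₚ q) ≈ₚ r *ₚ p +ₚ r *ₚ q
  *ₚ-distribˡ r p q = ≈ₚ-trans (*ₚ-comm r (p +ₚ q)) (≈ₚ-trans (*ₚ-distribʳ r p q) (+ₚ-cong (*ₚ-comm p r) (*ₚ-comm q r)))

  polyRing : CommutativeRing ℓ₁ ℓ₂
  polyRing = record
    { Carrier = Poly ; _≈_ = _≈ₚ_ ; _+_ = _+ₚ_ ; _*_ = _*ₚ_ ; -_ = -ₚ_ ; 0# = [] ; 1# = constant 1#
    ; isCommutativeRing = record
      { isRing = record
        { +-isAbelianGroup = record
          { isGroup = record
            { isMonoid = record
              { isSemigroup = record
                { isMagma = record
                  { isEquivalence = record { refl = ≈ₚ-refl ; sym = ≈ₚ-sym ; trans = ≈ₚ-trans }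
                  ; ∙-cong = +ₚ-cong }
                ; assoc = +ₚ-assoc }
              ; identity = (λ _ → ≈ₚ-refl) , +ₚ-identityʳ }
            ; inverse = -ₚ-inverseˡ , -ₚ-inverseʳ
            ; ⁻¹-cong = -ₚ-cong }
          ; comm = +ₚ-comm }
        ; *-cong = *ₚ-cong
        ; *-assoc = *ₚ-assoc
        ; *-identity = *ₚ-identityˡ , (λ p → ≈ₚ-trans (*ₚ-comm p (constant 1#)) (*ₚ-identityˡ p))
        ; distrib = *ₚ-distribˡ , *ₚ-distribʳ }
      ; *-comm = *ₚ-comm } }

  private
    module P = CommutativeRing polyRing
    module P⊕ = Algebra.Properties.CommutativeSemigroup P.+-commutativeSemigroup
    module MP = MatrixDefs polyRing
  open import Algebra.Properties.Monoid.Mult +-monoid using (_×_; ×-congʳ)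
  open import Algebra.Properties.CommutativeMonoid.Mult +-commutativeMonoid using (×-distrib-+)
  open import Algebra.Properties.Semiring.Mult semiring using (×-comm-*)
  open import Algebra.Properties.Ring ring using (-‿distribˡ-*)
  open import Algebra.Properties.Ring P.ring using () renaming (-‿distribˡ-* to -ₚ‿distribˡ-*ₚ)

  deriv : Poly → Poly
  deriv []      = []
  deriv (a ∷ p) = p +ₚ (0# ∷ deriv p)

  coeff-deriv : ∀ p k → coeff (deriv p) k ≈ suc k × coeff p (suc k)
  coeff-deriv []      k       = sym (×-zeroʳ (suc k))
  coeff-deriv (a ∷ p) zero    = coeff-+ p (0# ∷ deriv p) zero
  coeff-deriv (a ∷ p) (suc k) = trans (coeff-+ p (0# ∷ deriv p) (suc k)) (+-congˡ (coeff-deriv p k))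

  deriv-cong : ∀ {p q} → p ≈ₚ q → deriv p ≈ₚ deriv q
  deriv-cong {p} {q} e = mk≈ₚ λ k → trans (coeff-deriv p k) (trans (×-congʳ (suc k) (coeff-≈ e (suc k))) (sym (coeff-deriv q k)))

  deriv-+ : ∀ p q → deriv (p +ₚ q) ≈ₚ deriv p +ₚ deriv q
  deriv-+ p q = mk≈ₚ λ k → begin
    coeff (deriv (p +ₚ q)) k
      ≈⟨ coeff-deriv (p +ₚ q) k ⟩
    suc k × coeff (p +ₚ q) (suc k)
      ≈⟨ ×-congʳ (suc k) (coeff-+ p q (suc k)) ⟩
    suc k × (coeff p (suc k) + coeff q (suc k))
      ≈⟨ ×-distrib-+ _ _ (suc k) ⟩
    suc k × coeff p (suc k) + suc k × coeff q (suc k)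
      ≈⟨ +-cong (coeff-deriv p k) (coeff-deriv q k) ⟨
    coeff (deriv p) k + coeff (deriv q) k
      ≈⟨ coeff-+ (deriv p) (deriv q) k ⟨
    coeff (deriv p +ₚ deriv q) k ∎

  deriv-· : ∀ x q → deriv (x ·ₚ q) ≈ₚ x ·ₚ deriv q
  deriv-· x q = mk≈ₚ λ k → begin
    coeff (deriv (x ·ₚ q)) k        ≈⟨ coeff-deriv (x ·ₚ q) k ⟩
    suc k × coeff (x ·ₚ q) (suc k)  ≈⟨ ×-congʳ (suc k) (coeff-· x q (suc k)) ⟩
    suc k × (x * coeff q (suc k))   ≈⟨ ×-comm-* (suc k) x _ ⟨
    x * (suc k × coeff q (suc k))   ≈⟨ *-congˡ (coeff-deriv q k) ⟨
    x * coeff (deriv q) k           ≈⟨ coeff-· x (deriv q) k ⟨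
    coeff (x ·ₚ deriv q) k          ∎

  deriv-* : ∀ p q → deriv (p *ₚ q) ≈ₚ deriv p *ₚ q +ₚ p *ₚ deriv q
  deriv-* []      q = ≈ₚ-refl
  deriv-* (a ∷ p) q = P.trans expand (P.trans regroup collect)
    where
    A B C E : Poly
    A = a ·ₚ deriv q
    B = p *ₚ q
    C = 0# ∷ deriv p *ₚ q
    E = 0# ∷ p *ₚ deriv q
    expand : deriv (a ·ₚ q +ₚ (0# ∷ p *ₚ q)) ≈ₚ A +ₚ (B +ₚ (C +ₚ E))
    expand = P.trans (deriv-+ (a ·ₚ q) (0# ∷ p *ₚ q))
                     (+ₚ-cong (deriv-· a q) (+ₚ-cong (≈ₚ-refl {B}) (∷-cong (sym (+-identityʳ 0#)) (deriv-* p q))))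
    regroup : A +ₚ (B +ₚ (C +ₚ E)) ≈ₚ (B +ₚ C) +ₚ (A +ₚ E)
    regroup = P.trans (P⊕.x∙yz≈y∙xz A B (C +ₚ E))
                      (P.trans (+ₚ-cong (≈ₚ-refl {B}) (P⊕.x∙yz≈y∙xz A C E)) (P.sym (+ₚ-assoc B C (A +ₚ E))))
    collect : (B +ₚ C) +ₚ (A +ₚ E) ≈ₚ deriv (a ∷ p) *ₚ q +ₚ (a ∷ p) *ₚ deriv q
    collect = +ₚ-cong (P.sym (P.trans (*ₚ-distribʳ q p (0# ∷ deriv p)) (+ₚ-cong (≈ₚ-refl {B}) (0∷-*ₚ (deriv p) q)))) ≈ₚ-refl

  coeff-X*-zero : ∀ p → coeff (X *ₚ p) zero ≈ 0#
  coeff-X*-zero p = trans (coeff-+ (0# ·ₚ p) (0# ∷ constant 1# *ₚ p) zero) (trans (+-identityʳ _) (trans (coeff-· 0# p zero) (zeroˡ _)))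

  coeff-X*-suc : ∀ p k → coeff (X *ₚ p) (suc k) ≈ coeff p k
  coeff-X*-suc p k = begin
    coeff (0# ·ₚ p +ₚ (0# ∷ constant 1# *ₚ p)) (suc k)  ≈⟨ coeff-+ (0# ·ₚ p) (0# ∷ constant 1# *ₚ p) (suc k) ⟩
    coeff (0# ·ₚ p) (suc k) + coeff (constant 1# *ₚ p) k ≈⟨ +-cong (trans (coeff-· 0# p (suc k)) (zeroˡ _)) (coeff-≈ (*ₚ-identityˡ p) k) ⟩
    0# + coeff p k                                        ≈⟨ +-identityˡ _ ⟩
    coeff p k                                             ∎

  coeff-X*deriv : ∀ p d → coeff (X *ₚ deriv p) d ≈ d × coeff p d
  coeff-X*deriv p zero    = coeff-X*-zero (deriv p)
  coeff-X*deriv p (suc d) = trans (coeff-X*-suc (deriv p) d) (coeff-deriv p d)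

  coeff-∑ : ∀ {m} (f : Fin m → Poly) k → coeff (MP.∑ f) k ≈ ∑ (λ i → coeff (f i) k)
  coeff-∑ {zero}  f k = refl
  coeff-∑ {suc m} f k = trans (coeff-+ (f zero) (MP.∑ (f ∘ suc)) k) (+-congˡ (coeff-∑ (f ∘ suc) k))

  coeff-altSign* : ∀ j p d → coeff (MP.altSign j *ₚ p) d ≈ altSign j * coeff p d
  coeff-altSign* zero    p d = trans (coeff-≈ (*ₚ-identityˡ p) d) (sym (*-identityˡ _))
  coeff-altSign* (suc j) p d = begin
    coeff (-ₚ MP.altSign j *ₚ p) d    ≈⟨ coeff-≈ (P.sym (-ₚ‿distribˡ-*ₚ (MP.altSign j) p)) d ⟩
    coeff (-ₚ (MP.altSign j *ₚ p)) d  ≈⟨ coeff-‿ (MP.altSign j *ₚ p) d ⟩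
    - coeff (MP.altSign j *ₚ p) d     ≈⟨ -‿cong (coeff-altSign* j p d) ⟩
    - (altSign j * coeff p d)         ≈⟨ -‿distribˡ-* _ _ ⟩
    - altSign j * coeff p d           ∎

  DegreeAtMost : Poly → ℕ → Set ℓ₂
  DegreeAtMost p d = ∀ k → d ℕ.< k → coeff p k ≈ 0#

  degree-cong : ∀ {p q d} → p ≈ₚ q → DegreeAtMost p d → DegreeAtMost q d
  degree-cong e deg k d<k = trans (sym (coeff-≈ e k)) (deg k d<k)

  degree-constant : ∀ a → DegreeAtMost (constant a) 0
  degree-constant a (suc k) _ = refl

  degree-+ : ∀ {p q d} → DegreeAtMost p d → DegreeAtMost q d → DegreeAtMost (p +ₚ q) d
  degree-+ {p} {q} degp degq k d<k = trans (coeff-+ p q k) (trans (+-cong (degp k d<k) (degq k d<k)) (+-identityʳ 0#))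

  degree-‿ : ∀ {p d} → DegreeAtMost p d → DegreeAtMost (-ₚ p) d
  degree-‿ {p} degp k d<k = trans (coeff-‿ p k) (trans (-‿cong (degp k d<k)) -0#≈0#)

  degree-* : ∀ {p q d e} → DegreeAtMost p d → DegreeAtMost q e → DegreeAtMost (p *ₚ q) (d ℕ.+ e)
  degree-* {p} {q} {d} {e} degp degq k d+e<k = trans (coeff-* p q k) (∑-zero {suc k} term)
    where
    term : ∀ i → coeff p (toℕ i) * coeff q (k ∸ toℕ i) ≈ 0#
    term i with d ℕ.<? toℕ i
    ... | yes d<i = trans (*-congʳ (degp (toℕ i) d<i)) (zeroˡ _)
    ... | no  d≮i = trans (*-congˡ (degq (k ∸ toℕ i) e<k∸i)) (zeroʳ _)
      where
      e<k∸i : e ℕ.< k ∸ toℕ i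
      e<k∸i = ℕ.<-≤-trans (≡.subst (ℕ._< k ∸ d) (ℕ.m+n∸m≡n d e) (ℕ.∸-monoˡ-< d+e<k (ℕ.m≤m+n d e)))
                          (ℕ.∸-monoʳ-≤ k (ℕ.≮⇒≥ d≮i))

  degree-∑ : ∀ {m d} (f : Fin m → Poly) → (∀ i → DegreeAtMost (f i) d) → DegreeAtMost (MP.∑ f) d
  degree-∑ {zero}  f deg k _ = refl
  degree-∑ {suc m} f deg     = degree-+ {f zero} {MP.∑ (f ∘ suc)} (deg zero) (degree-∑ (f ∘ suc) (deg ∘ suc))

  degree-altSign : ∀ j → DegreeAtMost (MP.altSign j) 0
  degree-altSign zero    = degree-constant 1#
  degree-altSign (suc j) = degree-‿ {MP.altSign j} (degree-altSign j)

  det-degree : ∀ {n} (E : Fin n → Fin n → Poly) (d : Fin n → ℕ) →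
               (∀ i j → DegreeAtMost (E i j) (d i)) → DegreeAtMost (MP.det E) (ℕΣ.sum d)
  det-degree {zero}  E d deg = degree-constant 1#
  det-degree {suc n} E d deg = degree-∑ term (λ j → degree-* {MP.altSign (MP.toℕ' j)} (degree-altSign (MP.toℕ' j))
    (degree-* {E zero j} (deg zero j) (det-degree (λ a b → E (suc a) (punchIn j b)) (d ∘ suc) (λ a b → deg (suc a) (punchIn j b)))))
    where
    term : Fin (suc n) → Poly
    term j = MP.altSign (MP.toℕ' j) *ₚ (E zero j *ₚ MP.det (λ a b → E (suc a) (punchIn j b)))

  private
    coeff-linear-* : ∀ p → DegreeAtMost p 1 → ∀ q k → coeff (p *ₚ q) (suc k) ≈ coeff p 0 * coeff q (suc k) + coeff p 1 * coeff q k
    coeff-linear-* p degp q k = trans (coeff-* p q (suc k)) (+-congˡ (trans (+-congˡ (∑-zero {k} high)) (+-identityʳ _)))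
      where
      high : ∀ i → coeff p (suc (suc (toℕ i))) * coeff q (k ∸ suc (toℕ i)) ≈ 0#
      high i = trans (*-congʳ (degp _ (s≤s (s≤s z≤n)))) (zeroˡ _)

    toℕ'-≡ : ∀ {m} (j : Fin m) → MP.toℕ' j ≡ toℕ' j
    toℕ'-≡ zero    = ≡.refl
    toℕ'-≡ (suc j) = ≡.cong suc (toℕ'-≡ j)

  coeff-det-linear : ∀ {n} (E : Fin n → Fin n → Poly) → (∀ i j → DegreeAtMost (E i j) 1) →
                     coeff (MP.det E) n ≈ det (λ i j → coeff (E i j) 1)
  coeff-det-linear {zero}  E deg = refl
  coeff-det-linear {suc n} E deg = trans (coeff-∑ term (suc n)) (∑-cong top)
    where
    minorᴱ : Fin (suc n) → Fin n → Fin n → Poly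
    minorᴱ j a b = E (suc a) (punchIn j b)
    term : Fin (suc n) → Poly
    term j = MP.altSign (MP.toℕ' j) *ₚ (E zero j *ₚ MP.det (minorᴱ j))
    minor-degree : ∀ j → DegreeAtMost (MP.det (minorᴱ j)) n
    minor-degree j = ≡.subst (DegreeAtMost (MP.det (minorᴱ j))) (sum-ones n)
                             (det-degree (minorᴱ j) (λ _ → 1) (λ a b → deg (suc a) (punchIn j b)))
    top : ∀ j → coeff (term j) (suc n) ≈ altSign (toℕ' j) * (coeff (E zero j) 1 * det (λ a b → coeff (minorᴱ j a b) 1))
    top j = begin
      coeff (term j) (suc n)
        ≈⟨ coeff-altSign* (MP.toℕ' j) _ (suc n) ⟩
      altSign (MP.toℕ' j) * coeff (E zero j *ₚ MP.det (minorᴱ j)) (suc n)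
        ≈⟨ *-cong (reflexive (≡.cong altSign (toℕ'-≡ j))) (coeff-linear-* (E zero j) (deg zero j) (MP.det (minorᴱ j)) n) ⟩
      altSign (toℕ' j) * (coeff (E zero j) 0 * coeff (MP.det (minorᴱ j)) (suc n) + coeff (E zero j) 1 * coeff (MP.det (minorᴱ j)) n)
        ≈⟨ *-congˡ (trans (+-congʳ (trans (*-congˡ (minor-degree j (suc n) (ℕ.n<1+n n))) (zeroʳ _))) (+-identityˡ _)) ⟩
      altSign (toℕ' j) * (coeff (E zero j) 1 * coeff (MP.det (minorᴱ j)) n)
        ≈⟨ *-congˡ (*-congˡ (coeff-det-linear (minorᴱ j) (λ a b → deg (suc a) (punchIn j b)))) ⟩
      altSign (toℕ' j) * (coeff (E zero j) 1 * det (λ a b → coeff (minorᴱ j a b) 1)) ∎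

  torsionFree : TorsionFree R → TorsionFree polyRing
  torsionFree tf n p np≈0 = mk≈ₚ λ k → tf n (coeff p k) (trans (sym (coeff-× (suc n) p k)) (coeff-≈ np≈0 k))
    where
    module P× = Algebra.Properties.Monoid.Mult P.+-monoid
    coeff-× : ∀ m p k → coeff (P×._×_ m p) k ≈ m × coeff p k
    coeff-× zero    p k = refl
    coeff-× (suc m) p k = trans (coeff-+ p (P×._×_ m p) k) (+-congˡ (coeff-× m p k))

  module Evaluation {T : CommutativeRing ℓ₃ ℓ₄} (h : RingHom R T) (ξ : CommutativeRing.Carrier T) where

    private
      module T = CommutativeRing T
    open RingHom h
    open RingHomProperties h using (0#-homo)

    eval : Poly → T.Carrier
    eval []      = T.0#
    eval (a ∷ p) = ⟦ a ⟧ T.+ ξ T.* eval p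

    private
      eval-zero : ∀ p → (∀ k → coeff p k ≈ 0#) → eval p T.≈ T.0#
      eval-zero []      _  = T.refl
      eval-zero (a ∷ p) p≈0 =
        T.trans (T.+-cong (T.trans (cong (p≈0 zero)) 0#-homo) (T.trans (T.*-congˡ (eval-zero p (p≈0 ∘ suc))) (T.zeroʳ ξ)))
                (T.+-identityʳ T.0#)

      eval-cong : ∀ p q → p ≈ₚ q → eval p T.≈ eval q
      eval-cong []      []      e = T.refl
      eval-cong []      (b ∷ q) e = T.sym (eval-zero (b ∷ q) (sym ∘ coeff-≈ e))
      eval-cong (a ∷ p) []      e = eval-zero (a ∷ p) (coeff-≈ e)
      eval-cong (a ∷ p) (b ∷ q) e = T.+-cong (cong (coeff-≈ e zero)) (T.*-congˡ (eval-cong p q (mk≈ₚ (coeff-≈ e ∘ suc))))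

      eval-+ : ∀ p q → eval (p +ₚ q) T.≈ eval p T.+ eval q
      eval-+ []      q       = T.sym (T.+-identityˡ _)
      eval-+ (a ∷ p) []      = T.sym (T.+-identityʳ _)
      eval-+ (a ∷ p) (b ∷ q) = T.trans (T.+-cong (+-homo a b) (T.trans (T.*-congˡ (eval-+ p q)) (T.distribˡ ξ _ _))) (T⊕.interchange _ _ _ _)
        where module T⊕ = Algebra.Properties.CommutativeSemigroup T.+-commutativeSemigroup

      eval-· : ∀ x p → eval (x ·ₚ p) T.≈ ⟦ x ⟧ T.* eval p
      eval-· x []      = T.sym (T.zeroʳ _)
      eval-· x (a ∷ p) =
        T.trans (T.+-cong (*-homo x a) (T.trans (T.*-congˡ (eval-· x p)) (T⋆.x∙yz≈y∙xz ξ ⟦ x ⟧ (eval p))))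
                (T.sym (T.distribˡ ⟦ x ⟧ _ _))
        where module T⋆ = Algebra.Properties.CommutativeSemigroup T.*-commutativeSemigroup

      eval-* : ∀ p q → eval (p *ₚ q) T.≈ eval p T.* eval q
      eval-* []      q = T.sym (T.zeroˡ _)
      eval-* (a ∷ p) q =
        T.trans (eval-+ (a ·ₚ q) (0# ∷ p *ₚ q)) (T.trans (T.+-cong (eval-· a q) shifted) (T.sym (T.distribʳ (eval q) _ _)))
        where
        shifted : eval (0# ∷ p *ₚ q) T.≈ ξ T.* eval p T.* eval q
        shifted = T.trans (T.+-congʳ 0#-homo) (T.trans (T.+-identityˡ _) (T.trans (T.*-congˡ (eval-* p q)) (T.sym (T.*-assoc _ _ _))))

    evalHom : RingHom polyRing T
    evalHom = record
      { ⟦_⟧     = eval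
      ; cong    = λ {p} {q} → eval-cong p q
      ; +-homo  = eval-+
      ; *-homo  = eval-*
      ; 1#-homo = T.trans (T.+-cong 1#-homo (T.zeroʳ ξ)) (T.+-identityʳ _)
      }

    eval-constant : ∀ a → eval (constant a) T.≈ ⟦ a ⟧
    eval-constant a = T.trans (T.+-congˡ (T.zeroʳ ξ)) (T.+-identityʳ _)

    eval-X : eval X T.≈ ξ
    eval-X = T.trans (T.+-cong 0#-homo (T.*-congˡ (T.trans (T.+-cong 1#-homo (T.zeroʳ ξ)) (T.+-identityʳ _))))
                     (T.trans (T.+-identityˡ _) (T.*-identityʳ ξ))


module Integers where

  open import Data.Integer using (ℤ; +_; -[1+_]; _⊖_) renaming (_+_ to _+ᶻ_; _-_ to _-ᶻ_; _*_ to _*ᶻ_)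
  import Data.Integer.Properties as ℤᵖ
  import Data.Integer.Tactic.RingSolver as ℤ-Solver

  ℤ-ring : CommutativeRing 0ℓ 0ℓ
  ℤ-ring = ℤᵖ.+-*-commutativeRing

  private
    open Algebra.Properties.Monoid.Mult (CommutativeRing.+-monoid ℤ-ring) using () renaming (_×_ to _×ᶻ_)

    ×ᶻ≡* : ∀ m x → m ×ᶻ x ≡ + m *ᶻ x
    ×ᶻ≡* zero    x = ≡.sym (ℤᵖ.*-zeroˡ x)
    ×ᶻ≡* (suc m) x = ≡.trans (≡.cong (x +ᶻ_) (×ᶻ≡* m x)) (≡.sym (ℤᵖ.suc-* (+ m) x))

  ℤ-torsionFree : TorsionFree ℤ-ring
  ℤ-torsionFree n x nx≡0 with ℤᵖ.i*j≡0⇒i≡0∨j≡0 (+ suc n) (≡.trans (≡.sym (×ᶻ≡* (suc n) x)) nx≡0)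
  ... | inj₁ ()
  ... | inj₂ x≡0 = x≡0

  private
    module ⊖-Arithmetic where
      open ≡.≡-Reasoning

      ⊖-+ : ∀ a b c d → (a ⊖ b) +ᶻ (c ⊖ d) ≡ (a ℕ.+ c) ⊖ (b ℕ.+ d)
      ⊖-+ a b c d = begin
        (a ⊖ b) +ᶻ (c ⊖ d)               ≡⟨ ≡.cong₂ _+ᶻ_ (ℤᵖ.[+m]-[+n]≡m⊖n a b) (ℤᵖ.[+m]-[+n]≡m⊖n c d) ⟨
        (+ a -ᶻ + b) +ᶻ (+ c -ᶻ + d)     ≡⟨ regroup (+ a) (+ b) (+ c) (+ d) ⟩
        (+ a +ᶻ + c) -ᶻ (+ b +ᶻ + d)     ≡⟨ ≡.cong₂ _-ᶻ_ (ℤᵖ.pos-+ a c) (ℤᵖ.pos-+ b d) ⟨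
        + (a ℕ.+ c) -ᶻ + (b ℕ.+ d)       ≡⟨ ℤᵖ.[+m]-[+n]≡m⊖n (a ℕ.+ c) (b ℕ.+ d) ⟩
        (a ℕ.+ c) ⊖ (b ℕ.+ d)            ∎
        where
        regroup : ∀ A B C D → (A -ᶻ B) +ᶻ (C -ᶻ D) ≡ (A +ᶻ C) -ᶻ (B +ᶻ D)
        regroup = ℤ-Solver.solve-∀

      ⊖-* : ∀ a b c d → (a ⊖ b) *ᶻ (c ⊖ d) ≡ (a ℕ.* c ℕ.+ b ℕ.* d) ⊖ (a ℕ.* d ℕ.+ b ℕ.* c)
      ⊖-* a b c d = begin
        (a ⊖ b) *ᶻ (c ⊖ d)
          ≡⟨ ≡.cong₂ _*ᶻ_ (ℤᵖ.[+m]-[+n]≡m⊖n a b) (ℤᵖ.[+m]-[+n]≡m⊖n c d) ⟨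
        (+ a -ᶻ + b) *ᶻ (+ c -ᶻ + d)
          ≡⟨ expand (+ a) (+ b) (+ c) (+ d) ⟩
        (+ a *ᶻ + c +ᶻ + b *ᶻ + d) -ᶻ (+ a *ᶻ + d +ᶻ + b *ᶻ + c)
          ≡⟨ ≡.cong₂ _-ᶻ_ (pos² a c b d) (pos² a d b c) ⟨
        + (a ℕ.* c ℕ.+ b ℕ.* d) -ᶻ + (a ℕ.* d ℕ.+ b ℕ.* c)
          ≡⟨ ℤᵖ.[+m]-[+n]≡m⊖n (a ℕ.* c ℕ.+ b ℕ.* d) (a ℕ.* d ℕ.+ b ℕ.* c) ⟩
        (a ℕ.* c ℕ.+ b ℕ.* d) ⊖ (a ℕ.* d ℕ.+ b ℕ.* c) ∎
        where
        expand : ∀ A B C D → (A -ᶻ B) *ᶻ (C -ᶻ D) ≡ (A *ᶻ C +ᶻ B *ᶻ D) -ᶻ (A *ᶻ D +ᶻ B *ᶻ C)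
        expand = ℤ-Solver.solve-∀
        pos² : ∀ w x y z → + (w ℕ.* x ℕ.+ y ℕ.* z) ≡ + w *ᶻ + x +ᶻ + y *ᶻ + z
        pos² w x y z = ≡.trans (ℤᵖ.pos-+ (w ℕ.* x) (y ℕ.* z)) (≡.cong₂ _+ᶻ_ (ℤᵖ.pos-* w x) (ℤᵖ.pos-* y z))
    open ⊖-Arithmetic

  private
    module DifferenceIdentities (R : CommutativeRing ℓ₁ ℓ₂) where
      open CommutativeRing R
      open import Algebra.Properties.AbelianGroup +-abelianGroup using (⁻¹-∙-comm)
      open import Algebra.Properties.Ring ring using (-‿distribˡ-*; -‿distribʳ-*; -‿involutive)
      open import Algebra.Properties.CommutativeSemigroup +-commutativeSemigroup using (interchange)
      open import Relation.Binary.Reasoning.Setoid setoid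

      add-differences : ∀ x y z w → (x + z) - (y + w) ≈ (x - y) + (z - w)
      add-differences x y z w = trans (+-congˡ (sym (⁻¹-∙-comm y w))) (interchange x z (- y) (- w))

      shift-difference : ∀ x y u → x - y ≈ (u + x) - (u + y)
      shift-difference x y u = begin
        x - y                  ≈⟨ +-identityˡ _ ⟨
        0# + (x - y)           ≈⟨ +-congʳ (-‿inverseʳ u) ⟨
        (u - u) + (x - y)      ≈⟨ add-differences u u x y ⟨
        (u + x) - (u + y)      ∎

      multiply-differences : ∀ x y z w → (x * z + y * w) - (x * w + y * z) ≈ (x - y) * (z - w)
      multiply-differences x y z w = begin
        (x * z + y * w) - (x * w + y * z)  ≈⟨ add-differences (x * z) (x * w) (y * w) (y * z) ⟩
        (x * z - x * w) + (y * w - y * z)  ≈⟨ +-cong x[z-w] (trans [-y][z-w] (+-comm _ _)) ⟨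
        x * (z - w) + (- y) * (z - w)      ≈⟨ distribʳ (z - w) x (- y) ⟨
        (x - y) * (z - w)                  ∎
        where
        x[z-w] : x * (z - w) ≈ x * z - x * w
        x[z-w] = trans (distribˡ x z (- w)) (+-congˡ (sym (-‿distribʳ-* x w)))
        [-y][z-w] : (- y) * (z - w) ≈ - (y * z) + y * w
        [-y][z-w] = trans (distribˡ (- y) z (- w)) (+-cong (sym (-‿distribˡ-* y z))
                      (trans (sym (-‿distribˡ-* y (- w))) (trans (-‿cong (sym (-‿distribʳ-* y w))) (-‿involutive _))))

  -- Writing every integer as pos i ⊖ neg i turns the sign cases of ℤ's operations into ring
  -- identities between formal differences m × 1# - n × 1#.
  module IntegerHom (R : CommutativeRing ℓ₁ ℓ₂) where

    open CommutativeRing R hiding (zero) renaming (_+_ to _+ᴿ_; _-_ to _-ᴿ_; _*_ to _*ᴿ_)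
    open Algebra.Properties.Monoid.Mult +-monoid using (_×_; ×-homo-+)
    open Algebra.Properties.Semiring.Mult semiring using (×1-homo-*)
    open import Algebra.Properties.Ring ring using (-0#≈0#)
    open import Relation.Binary.Reasoning.Setoid setoid

    private
      ι : ℕ → Carrier
      ι n = n × 1#

    ⟦_⟧ᶻ : ℤ → Carrier
    ⟦ + n ⟧ᶻ      = ι n
    ⟦ -[1+ n ] ⟧ᶻ = - ι (suc n)

    private
      ⟦⊖⟧ : ∀ m n → ⟦ m ⊖ n ⟧ᶻ ≈ ι m -ᴿ ι n
      ⟦⊖⟧ zero    zero    = sym (trans (+-congˡ -0#≈0#) (+-identityʳ 0#))
      ⟦⊖⟧ (suc m) zero    = sym (trans (+-congˡ -0#≈0#) (+-identityʳ _))
      ⟦⊖⟧ zero    (suc n) = sym (+-identityˡ _)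
      ⟦⊖⟧ (suc m) (suc n) = begin
        ⟦ suc m ⊖ suc n ⟧ᶻ  ≡⟨ ≡.cong ⟦_⟧ᶻ (ℤᵖ.[1+m]⊖[1+n]≡m⊖n m n) ⟩
        ⟦ m ⊖ n ⟧ᶻ          ≈⟨ ⟦⊖⟧ m n ⟩
        ι m -ᴿ ι n          ≈⟨ DifferenceIdentities.shift-difference R (ι m) (ι n) 1# ⟩
        ι (suc m) -ᴿ ι (suc n) ∎

      pos neg : ℤ → ℕ
      pos (+ n)      = n
      pos -[1+ n ]   = 0
      neg (+ n)      = 0
      neg -[1+ n ]   = suc n

      pos⊖neg : ∀ i → pos i ⊖ neg i ≡ i
      pos⊖neg (+ n)    = ≡.refl
      pos⊖neg -[1+ n ] = ≡.refl

      ⟦⟧ᶻ-difference : ∀ i → ⟦ i ⟧ᶻ ≈ ι (pos i) -ᴿ ι (neg i)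
      ⟦⟧ᶻ-difference i = trans (reflexive (≡.cong ⟦_⟧ᶻ (≡.sym (pos⊖neg i)))) (⟦⊖⟧ (pos i) (neg i))

    ℤ-hom : RingHom ℤ-ring R
    ℤ-hom = record
      { ⟦_⟧     = ⟦_⟧ᶻ
      ; cong    = reflexive ∘ ≡.cong ⟦_⟧ᶻ
      ; +-homo  = +-homo
      ; *-homo  = *-homo
      ; 1#-homo = +-identityʳ 1#
      }
      where
      +-homo : ∀ i j → ⟦ i +ᶻ j ⟧ᶻ ≈ ⟦ i ⟧ᶻ +ᴿ ⟦ j ⟧ᶻ
      +-homo i j = begin
        ⟦ i +ᶻ j ⟧ᶻ
          ≡⟨ ≡.cong ⟦_⟧ᶻ (≡.cong₂ _+ᶻ_ (pos⊖neg i) (pos⊖neg j)) ⟨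
        ⟦ (m₁ ⊖ n₁) +ᶻ (m₂ ⊖ n₂) ⟧ᶻ
          ≡⟨ ≡.cong ⟦_⟧ᶻ (⊖-+ m₁ n₁ m₂ n₂) ⟩
        ⟦ (m₁ ℕ.+ m₂) ⊖ (n₁ ℕ.+ n₂) ⟧ᶻ
          ≈⟨ ⟦⊖⟧ (m₁ ℕ.+ m₂) (n₁ ℕ.+ n₂) ⟩
        ι (m₁ ℕ.+ m₂) -ᴿ ι (n₁ ℕ.+ n₂)
          ≈⟨ +-cong (×-homo-+ 1# m₁ m₂) (-‿cong (×-homo-+ 1# n₁ n₂)) ⟩
        (ι m₁ +ᴿ ι m₂) -ᴿ (ι n₁ +ᴿ ι n₂)
          ≈⟨ DifferenceIdentities.add-differences R (ι m₁) (ι n₁) (ι m₂) (ι n₂) ⟩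
        (ι m₁ -ᴿ ι n₁) +ᴿ (ι m₂ -ᴿ ι n₂)
          ≈⟨ +-cong (⟦⟧ᶻ-difference i) (⟦⟧ᶻ-difference j) ⟨
        ⟦ i ⟧ᶻ +ᴿ ⟦ j ⟧ᶻ ∎
        where
        m₁ n₁ m₂ n₂ : ℕ
        m₁ = pos i
        n₁ = neg i
        m₂ = pos j
        n₂ = neg j
      ι-+* : ∀ m₁ n₁ m₂ n₂ → ι (m₁ ℕ.* m₂ ℕ.+ n₁ ℕ.* n₂) ≈ ι m₁ *ᴿ ι m₂ +ᴿ ι n₁ *ᴿ ι n₂
      ι-+* m₁ n₁ m₂ n₂ = trans (×-homo-+ 1# (m₁ ℕ.* m₂) (n₁ ℕ.* n₂)) (+-cong (×1-homo-* m₁ m₂) (×1-homo-* n₁ n₂))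
      *-homo : ∀ i j → ⟦ i *ᶻ j ⟧ᶻ ≈ ⟦ i ⟧ᶻ *ᴿ ⟦ j ⟧ᶻ
      *-homo i j = begin
        ⟦ i *ᶻ j ⟧ᶻ
          ≡⟨ ≡.cong ⟦_⟧ᶻ (≡.cong₂ _*ᶻ_ (pos⊖neg i) (pos⊖neg j)) ⟨
        ⟦ (m₁ ⊖ n₁) *ᶻ (m₂ ⊖ n₂) ⟧ᶻ
          ≡⟨ ≡.cong ⟦_⟧ᶻ (⊖-* m₁ n₁ m₂ n₂) ⟩
        ⟦ (m₁ ℕ.* m₂ ℕ.+ n₁ ℕ.* n₂) ⊖ (m₁ ℕ.* n₂ ℕ.+ n₁ ℕ.* m₂) ⟧ᶻ
          ≈⟨ ⟦⊖⟧ (m₁ ℕ.* m₂ ℕ.+ n₁ ℕ.* n₂) (m₁ ℕ.* n₂ ℕ.+ n₁ ℕ.* m₂) ⟩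
        ι (m₁ ℕ.* m₂ ℕ.+ n₁ ℕ.* n₂) -ᴿ ι (m₁ ℕ.* n₂ ℕ.+ n₁ ℕ.* m₂)
          ≈⟨ +-cong (ι-+* m₁ n₁ m₂ n₂) (-‿cong (ι-+* m₁ n₁ n₂ m₂)) ⟩
        (ι m₁ *ᴿ ι m₂ +ᴿ ι n₁ *ᴿ ι n₂) -ᴿ (ι m₁ *ᴿ ι n₂ +ᴿ ι n₁ *ᴿ ι m₂)
          ≈⟨ DifferenceIdentities.multiply-differences R (ι m₁) (ι n₁) (ι m₂) (ι n₂) ⟩
        (ι m₁ -ᴿ ι n₁) *ᴿ (ι m₂ -ᴿ ι n₂)
          ≈⟨ *-cong (⟦⟧ᶻ-difference i) (⟦⟧ᶻ-difference j) ⟨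
        ⟦ i ⟧ᶻ *ᴿ ⟦ j ⟧ᶻ ∎
        where
        m₁ n₁ m₂ n₂ : ℕ
        m₁ = pos i
        n₁ = neg i
        m₂ = pos j
        n₂ = neg j

open Integers using (ℤ-ring; ℤ-torsionFree; module IntegerHom)

Multivariate : ℕ → CommutativeRing 0ℓ 0ℓ
Multivariate zero    = ℤ-ring
Multivariate (suc m) = Polynomial.polyRing (Multivariate m)

var : ∀ m → Fin m → CommutativeRing.Carrier (Multivariate m)
var (suc m) zero    = Polynomial.X (Multivariate m)
var (suc m) (suc i) = Polynomial.constant (Multivariate m) (var m i)

Multivariate-torsionFree : ∀ m → TorsionFree (Multivariate m)
Multivariate-torsionFree zero    = ℤ-torsionFree
Multivariate-torsionFree (suc m) = Polynomial.torsionFree (Multivariate m) (Multivariate-torsionFree m)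

module _ (T : CommutativeRing ℓ₁ ℓ₂) where

  open CommutativeRing T using (Carrier; _≈_; trans)

  substitute : ∀ m → (Fin m → Carrier) → RingHom (Multivariate m) T
  substitute zero    ρ = IntegerHom.ℤ-hom T
  substitute (suc m) ρ = Polynomial.Evaluation.evalHom (Multivariate m) (substitute m (ρ ∘ suc)) (ρ zero)

  substitute-var : ∀ m ρ i → RingHom.⟦ substitute m ρ ⟧ (var m i) ≈ ρ i
  substitute-var (suc m) ρ zero    = Polynomial.Evaluation.eval-X (Multivariate m) (substitute m (ρ ∘ suc)) (ρ zero)
  substitute-var (suc m) ρ (suc i) = trans (Polynomial.Evaluation.eval-constant (Multivariate m) (substitute m (ρ ∘ suc)) (ρ zero) (var m i))
                                           (substitute-var m (ρ ∘ suc) i)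


module Newton (S : CommutativeRing ℓ₁ ℓ₂) where

  open CommutativeRing S hiding (zero)
  open MatrixDefs S
  open Summation S
  open Determinant S using (Matrix)
  open MatrixAlgebra S
  open Polynomial S
  open import Algebra.Properties.Ring (CommutativeRing.ring polyRing) using () renaming (-‿distribˡ-* to -ₚ‿distribˡ-*ₚ)
  open Algebra.Properties.Monoid.Mult +-monoid using (_×_; ×-homo-+; ×-congʳ)
  open Algebra.Properties.CommutativeMonoid.Mult +-commutativeMonoid using (×-distrib-+)
  open import Algebra.Properties.Ring ring using (-0#≈0#; x∙y⁻¹≈ε⇒x≈y; +-inverseʳ-unique; +-identityʳ-unique)
  open import Relation.Binary.Reasoning.Setoid setoid
  private
    module ⊕  = Algebra.Properties.CommutativeSemigroup +-commutativeSemigroup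
    module P  = CommutativeRing polyRing
    module MP = MatrixDefs polyRing
    module SP = Summation polyRing
    module DP = Determinant polyRing

    move-left : ∀ {x t u} → x ≈ t + u → x - t ≈ u
    move-left {x} {t} {u} x≈t+u = begin
      x - t            ≈⟨ +-congʳ x≈t+u ⟩
      (t + u) - t      ≈⟨ +-congʳ (+-comm t u) ⟩
      (u + t) - t      ≈⟨ +-assoc u t (- t) ⟩
      u + (t - t)      ≈⟨ +-congˡ (-‿inverseʳ t) ⟩
      u + 0#           ≈⟨ +-identityʳ u ⟩
      u                ∎

    move-right : ∀ {x t u} → x - t ≈ u → x ≈ t + u
    move-right {x} {t} {u} x-t≈u = begin
      x              ≈⟨ +-identityʳ x ⟨
      x + 0#         ≈⟨ +-congˡ (-‿inverseˡ t) ⟨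
      x + (- t + t)  ≈⟨ +-assoc x (- t) t ⟨
      (x - t) + t    ≈⟨ +-congʳ x-t≈u ⟩
      u + t          ≈⟨ +-comm u t ⟩
      t + u          ∎

  module CharacteristicPolynomial {n} (M : Matrix n) where

    E : Fin n → Fin n → Poly
    E = MP.charMat (λ i j → constant (M i j)) X

    χ : Poly
    χ = MP.det E

    c : ℕ → Carrier
    c = coeff χ

    Adj : Fin n → Fin n → Poly
    Adj = DP.adjugate E

    B : ℕ → Matrix n
    B d j i = coeff (Adj j i) d

    private
      coeff-ind-zero : ∀ β → coeff (MP.ind β) zero ≈ ind β
      coeff-ind-zero true  = refl
      coeff-ind-zero false = refl

      coeff-ind-suc : ∀ β k → coeff (MP.ind β) (suc k) ≈ 0#
      coeff-ind-suc true  k = refl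
      coeff-ind-suc false k = refl

      coeff-ind* : ∀ β p k → coeff (MP.ind β *ₚ p) k ≈ ind β * coeff p k
      coeff-ind* true  p k = coeff-constant* 1# p k
      coeff-ind* false p k = sym (zeroˡ _)

      coeff-E : ∀ i j k → coeff (E i j) k ≈ coeff (X *ₚ MP.ind ⌊ i ≟ j ⌋) k + - coeff (constant (M i j)) k
      coeff-E i j k = trans (coeff-+ (X *ₚ MP.ind ⌊ i ≟ j ⌋) (-ₚ constant (M i j)) k) (+-congˡ (coeff-‿ (constant (M i j)) k))

      coeff-E-1 : ∀ i j → coeff (E i j) 1 ≈ δ i j
      coeff-E-1 i j = trans (coeff-E i j 1)
        (trans (+-cong (trans (coeff-X*-suc (MP.ind ⌊ i ≟ j ⌋) 0) (coeff-ind-zero ⌊ i ≟ j ⌋)) -0#≈0#) (+-identityʳ _))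

      coeff-E-2+ : ∀ i j k → coeff (E i j) (suc (suc k)) ≈ 0#
      coeff-E-2+ i j k = trans (coeff-E i j (suc (suc k)))
        (trans (+-cong (trans (coeff-X*-suc (MP.ind ⌊ i ≟ j ⌋) (suc k)) (coeff-ind-suc ⌊ i ≟ j ⌋ k)) -0#≈0#) (+-identityʳ _))

      E-degree : ∀ i j → DegreeAtMost (E i j) 1
      E-degree i j (suc zero)    (s≤s ())
      E-degree i j (suc (suc k)) _ = coeff-E-2+ i j k

      deriv-E : ∀ i j → deriv (E i j) ≈ₚ MP.ind ⌊ i ≟ j ⌋
      deriv-E i j = mk≈ₚ λ
        { zero    → trans (coeff-deriv (E i j) 0) (trans (+-identityʳ _) (trans (coeff-E-1 i j) (sym (coeff-ind-zero ⌊ i ≟ j ⌋))))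
        ; (suc k) → trans (coeff-deriv (E i j) (suc k))
                      (trans (×-congʳ (suc (suc k)) (coeff-E-2+ i j k)) (trans (×-zeroʳ (suc (suc k))) (sym (coeff-ind-suc ⌊ i ≟ j ⌋ k)))) }

      coeff-E*Adj : ∀ k j i d → coeff (E k j *ₚ Adj j i) d ≈ coeff (X *ₚ (MP.ind ⌊ k ≟ j ⌋ *ₚ Adj j i)) d - M k j * B d j i
      coeff-E*Adj k j i d = begin
        coeff (E k j *ₚ Adj j i) d
          ≈⟨ coeff-≈ (*ₚ-distribʳ (Adj j i) (X *ₚ MP.ind ⌊ k ≟ j ⌋) (-ₚ constant (M k j))) d ⟩
        coeff ((X *ₚ MP.ind ⌊ k ≟ j ⌋) *ₚ Adj j i +ₚ (-ₚ constant (M k j)) *ₚ Adj j i) d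
          ≈⟨ coeff-+ ((X *ₚ MP.ind ⌊ k ≟ j ⌋) *ₚ Adj j i) ((-ₚ constant (M k j)) *ₚ Adj j i) d ⟩
        coeff ((X *ₚ MP.ind ⌊ k ≟ j ⌋) *ₚ Adj j i) d + coeff ((-ₚ constant (M k j)) *ₚ Adj j i) d
          ≈⟨ +-cong (coeff-≈ (*ₚ-assoc X (MP.ind ⌊ k ≟ j ⌋) (Adj j i)) d) negated ⟩
        coeff (X *ₚ (MP.ind ⌊ k ≟ j ⌋ *ₚ Adj j i)) d - M k j * B d j i ∎
        where
        negated : coeff ((-ₚ constant (M k j)) *ₚ Adj j i) d ≈ - (M k j * B d j i)
        negated = begin
          coeff ((-ₚ constant (M k j)) *ₚ Adj j i) d  ≈⟨ coeff-≈ (P.sym (-ₚ‿distribˡ-*ₚ (constant (M k j)) (Adj j i))) d ⟩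
          coeff (-ₚ (constant (M k j) *ₚ Adj j i)) d  ≈⟨ coeff-‿ (constant (M k j) *ₚ Adj j i) d ⟩
          - coeff (constant (M k j) *ₚ Adj j i) d     ≈⟨ -‿cong (coeff-constant* (M k j) (Adj j i) d) ⟩
          - (M k j * B d j i)                         ∎

    adjugate-identity : ∀ d k i → coeff (X *ₚ Adj k i) d ≈ ∑ (λ j → M k j * B d j i) + δ k i * c d
    adjugate-identity d k i = move-right (begin
      coeff (X *ₚ Adj k i) d - ∑ (λ j → M k j * B d j i)
        ≈⟨ +-cong (coeff-≈ (P.sym shifted) d) (∑-neg (λ j → M k j * B d j i)) ⟩
      coeff (MP.∑ (λ j → X *ₚ (MP.ind ⌊ k ≟ j ⌋ *ₚ Adj j i))) d + ∑ (λ j → - (M k j * B d j i))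
        ≈⟨ +-congʳ (coeff-∑ (λ j → X *ₚ (MP.ind ⌊ k ≟ j ⌋ *ₚ Adj j i)) d) ⟩
      ∑ (λ j → coeff (X *ₚ (MP.ind ⌊ k ≟ j ⌋ *ₚ Adj j i)) d) + ∑ (λ j → - (M k j * B d j i))
        ≈⟨ ∑-+ (λ j → coeff (X *ₚ (MP.ind ⌊ k ≟ j ⌋ *ₚ Adj j i)) d) (λ j → - (M k j * B d j i)) ⟨
      ∑ (λ j → coeff (X *ₚ (MP.ind ⌊ k ≟ j ⌋ *ₚ Adj j i)) d - M k j * B d j i)
        ≈⟨ ∑-cong (λ j → coeff-E*Adj k j i d) ⟨
      ∑ (λ j → coeff (E k j *ₚ Adj j i) d)
        ≈⟨ coeff-∑ (λ j → E k j *ₚ Adj j i) d ⟨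
      coeff (MP.∑ (λ j → E k j *ₚ Adj j i)) d
        ≈⟨ coeff-≈ (DP.adjugate-inverse E k i) d ⟩
      coeff (MP.ind ⌊ k ≟ i ⌋ *ₚ χ) d
        ≈⟨ coeff-ind* ⌊ k ≟ i ⌋ χ d ⟩
      δ k i * c d ∎)
      where
      shifted : MP.∑ (λ j → X *ₚ (MP.ind ⌊ k ≟ j ⌋ *ₚ Adj j i)) ≈ₚ X *ₚ Adj k i
      shifted = P.trans (P.sym (SP.∑-*ˡ X (λ j → MP.ind ⌊ k ≟ j ⌋ *ₚ Adj j i)))
                        (*ₚ-cong (≈ₚ-refl {X}) (SP.∑-δʳ k (λ j → Adj j i)))

    deriv-χ : deriv χ ≈ₚ MP.∑ (λ i → Adj i i)
    deriv-χ = P.trans (Jacobi.jacobi E) (SP.∑-cong (λ i → DP.det-cong (DP.replaceRow-cong E i (deriv-E i))))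
      where module Jacobi = DP.Jacobi deriv deriv-cong deriv-+ deriv-*

    -- By Jacobi's formula χ′ = tr (adj E), so d × c d is the X^d-coefficient of X · tr (adj E).
    newton-identity : ∀ d → d × c d ≈ trace (M ⊗ B d) + n × c d
    newton-identity d = move-right (begin
      d × c d - trace (M ⊗ B d)
        ≈⟨ +-cong (sym diagonal) (∑-neg (λ k → (M ⊗ B d) k k)) ⟩
      ∑ (λ k → coeff (X *ₚ Adj k k) d) + ∑ (λ k → - (M ⊗ B d) k k)
        ≈⟨ ∑-+ (λ k → coeff (X *ₚ Adj k k) d) (λ k → - (M ⊗ B d) k k) ⟨
      ∑ (λ k → coeff (X *ₚ Adj k k) d - (M ⊗ B d) k k)
        ≈⟨ ∑-cong (λ k → move-left (adjugate-identity d k k)) ⟩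
      ∑ {n} (λ k → δ k k * c d)
        ≈⟨ ∑-cong {n} (λ k → trans (reflexive (≡.cong (λ β → ind β * c d) (⌊≟⌋-refl k))) (*-identityˡ (c d))) ⟩
      ∑ {n} (λ _ → c d)
        ≈⟨ ∑-const n (c d) ⟩
      n × c d ∎)
      where
      diagonal : ∑ (λ k → coeff (X *ₚ Adj k k) d) ≈ d × c d
      diagonal = begin
        ∑ (λ k → coeff (X *ₚ Adj k k) d)     ≈⟨ coeff-∑ (λ k → X *ₚ Adj k k) d ⟨
        coeff (MP.∑ (λ k → X *ₚ Adj k k)) d  ≈⟨ coeff-≈ (SP.∑-*ˡ X (λ k → Adj k k)) d ⟨
        coeff (X *ₚ MP.∑ (λ k → Adj k k)) d  ≈⟨ coeff-≈ (*ₚ-cong (≈ₚ-refl {X}) deriv-χ) d ⟨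
        coeff (X *ₚ deriv χ) d               ≈⟨ coeff-X*deriv χ d ⟩
        d × c d                              ∎

    adjugate-recurrence : ∀ d k i → B d k i ≈ (M ⊗ B (suc d)) k i + δ k i * c (suc d)
    adjugate-recurrence d k i = trans (sym (coeff-X*-suc (Adj k i) d)) (adjugate-identity (suc d) k i)

    private
      rowDegree : Fin n → Fin n → ℕ
      rowDegree i a = if ⌊ a ≟ i ⌋ then 0 else 1

      sum-rowDegree : ∀ {m} (i : Fin m) → suc (ℕΣ.sum (λ a → if ⌊ a ≟ i ⌋ then 0 else 1)) ≡ m
      sum-rowDegree {suc m} zero    = ≡.cong suc (sum-ones m)
      sum-rowDegree {suc m} (suc i) =
        ≡.cong suc (≡.trans (≡.cong suc (ℕΣ.sum-cong-≗ (λ a → ≡.cong (if_then 0 else 1) (⌊suc≟suc⌋ a i)))) (sum-rowDegree i))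

      Adj-row-degree : ∀ i j a x → DegreeAtMost (DP.replaceRow E i (SP.δ j) a x) (rowDegree i a)
      Adj-row-degree i j a x with a ≟ i
      ... | yes ≡.refl = degree-cong (P.sym (P.reflexive (≡.cong-app (updateAt-updates a E) x))) (ind-degree ⌊ j ≟ x ⌋)
        where
        ind-degree : ∀ β → DegreeAtMost (MP.ind β) 0
        ind-degree β (suc k) _ = coeff-ind-suc β k
      ... | no a≢i     = degree-cong (P.sym (P.reflexive (≡.cong-app (updateAt-minimal a i E a≢i) x))) (E-degree a x)

    B-vanishes : ∀ d → n ≤ d → ∀ j i → B d j i ≈ 0#
    B-vanishes d n≤d j i =
      det-degree (DP.replaceRow E i (SP.δ j)) (rowDegree i) (Adj-row-degree i j) d (≡.subst (_≤ d) (≡.sym (sum-rowDegree i)) n≤d)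

    c-vanishes : ∀ d → n < d → c d ≈ 0#
    c-vanishes d n<d = det-degree E (λ _ → 1) (λ i j → E-degree i j) d (≡.subst (_< d) (≡.sym (sum-ones n)) n<d)

    c-top : c n ≈ 1#
    c-top = trans (coeff-det-linear E E-degree) (trans (Determinant.det-cong S coeff-E-1) (Determinant.det-δ S n))

    trace-recurrence : ∀ j d → trace (M ^ j ⊗ B d) ≈ trace (M ^ suc j ⊗ B (suc d)) + c (suc d) * trace (M ^ j)
    trace-recurrence j d = trace-⊗-recurrence (M ^ j) M (B d) (B (suc d)) (c (suc d)) (adjugate-recurrence d)

    trace-vanishes : ∀ j d → n ≤ d → trace (M ^ j ⊗ B d) ≈ 0#
    trace-vanishes j d n≤d = ∑-zero (λ k → ∑-zero (λ l → trans (*-congˡ (B-vanishes d n≤d l k)) (zeroʳ _)))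

  module _ (torsionFree : TorsionFree S) {n} (M N : Matrix n) (same-traces : ∀ j → trace (M ^ j) ≈ trace (N ^ j)) where

    private
      module A = CharacteristicPolynomial M
      module B = CharacteristicPolynomial N

      AgreeFrom : ℕ → Set ℓ₂
      AgreeFrom d = ∀ e → d ≤ e → A.c e ≈ B.c e

      traces-agree : ∀ f d → n ≤ d ℕ.+ f → AgreeFrom (suc d) → ∀ j → trace (M ^ j ⊗ A.B d) ≈ trace (N ^ j ⊗ B.B d)
      traces-agree zero    d n≤d   _     j = trans (A.trace-vanishes j d n≤d′) (sym (B.trace-vanishes j d n≤d′))
        where
        n≤d′ : n ≤ d
        n≤d′ = ≡.subst (n ≤_) (ℕ.+-identityʳ d) n≤d
      traces-agree (suc f) d n≤d+f agree j = begin
        trace (M ^ j ⊗ A.B d)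
          ≈⟨ A.trace-recurrence j d ⟩
        trace (M ^ suc j ⊗ A.B (suc d)) + A.c (suc d) * trace (M ^ j)
          ≈⟨ +-cong (traces-agree f (suc d) n≤d+f′ (λ e → agree e ∘ ℕ.<⇒≤) (suc j)) (*-cong (agree (suc d) ℕ.≤-refl) (same-traces j)) ⟩
        trace (N ^ suc j ⊗ B.B (suc d)) + B.c (suc d) * trace (N ^ j)
          ≈⟨ B.trace-recurrence j d ⟨
        trace (N ^ j ⊗ B.B d) ∎
        where
        n≤d+f′ : n ≤ suc d ℕ.+ f
        n≤d+f′ = ≡.subst (n ≤_) (ℕ.+-suc d f) n≤d+f

      ×-cancel : ∀ k {x y} → suc k × x ≈ suc k × y → x ≈ y
      ×-cancel k {x} {y} kx≈ky = x∙y⁻¹≈ε⇒x≈y x y (torsionFree k (x - y) (begin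
        suc k × (x - y)              ≈⟨ ×-distrib-+ x (- y) (suc k) ⟩
        suc k × x + suc k × (- y)    ≈⟨ +-congʳ kx≈ky ⟩
        suc k × y + suc k × (- y)    ≈⟨ ×-distrib-+ y (- y) (suc k) ⟨
        suc k × (y - y)              ≈⟨ ×-congʳ (suc k) (-‿inverseʳ y) ⟩
        suc k × 0#                   ≈⟨ ×-zeroʳ (suc k) ⟩
        0#                           ∎))

      excess-multiple : ∀ d m {x t} → d × x ≈ t + (d ℕ.+ m) × x → m × x ≈ - t
      excess-multiple d m {x} {t} eq = +-inverseʳ-unique t (m × x) (+-identityʳ-unique (d × x) (t + m × x) (begin
        d × x + (t + m × x)  ≈⟨ ⊕.x∙yz≈y∙xz (d × x) t (m × x) ⟩
        t + (d × x + m × x)  ≈⟨ +-congˡ (×-homo-+ x d m) ⟨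
        t + (d ℕ.+ m) × x    ≈⟨ eq ⟨
        d × x                ∎))

      top-coefficients-agree : ∀ e → n ≤ e → A.c e ≈ B.c e
      top-coefficients-agree e n≤e with ℕ.m≤n⇒m<n∨m≡n n≤e
      ... | inj₁ n<e    = trans (A.c-vanishes e n<e) (sym (B.c-vanishes e n<e))
      ... | inj₂ ≡.refl = trans A.c-top (sym B.c-top)

      -- Downward induction on d with fuel f ≥ n − d.  For d < n, newton-identity reads
      -- (n − d) × c d ≈ − tr (M B_d), whose right side only involves traces of powers and
      -- coefficients above d (traces-agree); torsion-freeness cancels n − d.
      coefficients-agree : ∀ f d → n ≤ d ℕ.+ f → AgreeFrom d
      coefficients-agree zero    d n≤d e d≤e = top-coefficients-agree e (ℕ.≤-trans (≡.subst (n ≤_) (ℕ.+-identityʳ d) n≤d) d≤e)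
      coefficients-agree (suc f) d n≤d+f e d≤e with ℕ.m≤n⇒m<n∨m≡n d≤e
      ... | inj₁ d<e    = coefficients-agree f (suc d) (≡.subst (n ≤_) (ℕ.+-suc d f) n≤d+f) e d<e
      ... | inj₂ ≡.refl with n ℕ.≤? d
      ...   | yes n≤d = top-coefficients-agree d n≤d
      ...   | no  n≰d = ×-cancel k (begin
        suc k × A.c d
          ≈⟨ excess-multiple d (suc k) (≡.subst (λ m → d × A.c d ≈ trace (M ⊗ A.B d) + m × A.c d) n≡d+k+1 (A.newton-identity d)) ⟩
        - trace (M ⊗ A.B d)
          ≈⟨ -‿cong (trans (sym (trace-^1⊗ M (A.B d))) (trans (traces-agree n d (ℕ.m≤n+m n d) higher 1) (trace-^1⊗ N (B.B d)))) ⟩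
        - trace (N ⊗ B.B d)
          ≈⟨ excess-multiple d (suc k) (≡.subst (λ m → d × B.c d ≈ trace (N ⊗ B.B d) + m × B.c d) n≡d+k+1 (B.newton-identity d)) ⟨
        suc k × B.c d ∎)
        where
        k : ℕ
        k = n ℕ.∸ suc d
        n≡d+k+1 : n ≡ d ℕ.+ suc k
        n≡d+k+1 = ≡.sym (≡.trans (ℕ.+-suc d k) (ℕ.m+[n∸m]≡n (ℕ.≰⇒> n≰d)))
        higher : AgreeFrom (suc d)
        higher = coefficients-agree f (suc d) (≡.subst (n ≤_) (ℕ.+-suc d f) n≤d+f)

    χ-determined-by-traces : CharacteristicPolynomial.χ M ≈ₚ CharacteristicPolynomial.χ N
    χ-determined-by-traces = mk≈ₚ λ d → coefficients-agree n d (ℕ.m≤n+m n d) d ℕ.≤-refl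


module PairSums (R : CommutativeRing ℓ₁ ℓ₂) where

  open import Data.Product using (_×_)

  open CommutativeRing R hiding (zero)
  open MatrixDefs R
  open Summation R
  open import Relation.Binary.Reasoning.Setoid setoid

  ∑² : ∀ {n} → (Vec (Fin n) 2 → Carrier) → Carrier
  ∑² f = ∑ (λ a → ∑ (λ b → f (a ∷ b ∷ [])))

  private
    ×↔Vec₂ : ∀ {A : Set} → (A × A) ↔ Vec A 2
    ×↔Vec₂ = mk↔ₛ′ (λ (a , b) → a ∷ b ∷ []) (λ { (a ∷ b ∷ []) → a , b })
                   (λ { (a ∷ b ∷ []) → ≡.refl }) (λ (a , b) → ≡.refl)

    pairs : ∀ {n} → Fin (n ℕ.* n) ↔ Vec (Fin n) 2
    pairs {n} = ×↔Vec₂ ↔-∘ *↔× {n} {n}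

    ∑²-pairs : ∀ {n} (f : Vec (Fin n) 2 → Carrier) → ∑ (f ∘ Inverse.to pairs) ≈ ∑² f
    ∑²-pairs {n} f = trans (∑-combine {n} (f ∘ Inverse.to pairs))
                           (∑-cong (λ a → ∑-cong (λ b → reflexive (≡.cong (λ (a , b) → f (a ∷ b ∷ [])) (remQuot-combine a b)))))

  ∑²-permute : ∀ {n} (σ : Vec (Fin n) 2 ↔ Vec (Fin n) 2) (f : Vec (Fin n) 2 → Carrier) → ∑² (f ∘ Inverse.to σ) ≈ ∑² f
  ∑²-permute {n} σ f = begin
    ∑² (f ∘ to σ)            ≈⟨ ∑²-pairs (f ∘ to σ) ⟨
    ∑ (f ∘ to σ ∘ to pairs)  ≈⟨ ∑-cong (λ i → reflexive (≡.cong f (≡.sym (strictlyInverseˡ pairs (to σ (to pairs i)))))) ⟩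
    ∑ (f ∘ to pairs ∘ to π)  ≈⟨ ∑-permute (f ∘ to pairs) π ⟨
    ∑ (f ∘ to pairs)         ≈⟨ ∑²-pairs f ⟩
    ∑² f                     ∎
    where
    open Inverse
    π : Fin (n ℕ.* n) ↔ Fin (n ℕ.* n)
    π = ↔-sym pairs ↔-∘ (σ ↔-∘ pairs)

module ColourRefinement {n} (G H : Graph n) where

  open import Data.Product using (_×_)

  Same : ℕ → Vec (Fin n) 2 → Vec (Fin n) 2 → Set
  Same = SameX (AdjMat G) (AdjMat H)

  Same⇒Same₀ : ∀ r {x y} → Same r x y → Same 0 x y
  Same⇒Same₀ zero    same = same
  Same⇒Same₀ (suc r) same = Same⇒Same₀ r (proj₁ same)

  Same⇒Same₁ : ∀ r {x y} → Same (suc r) x y → Same 1 x y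
  Same⇒Same₁ zero    same = same
  Same⇒Same₁ (suc r) same = Same⇒Same₁ r (proj₁ same)

  module _ {a b a′ b′ : Fin n} (same : Same 0 (a ∷ b ∷ []) (a′ ∷ b′ ∷ [])) where

    private
      entry₀₁ : (not ⌊ a ≟ b ⌋ , AdjMat G a b) ≡ (not ⌊ a′ ≟ b′ ⌋ , AdjMat H a′ b′)
      entry₀₁ = ≡.cong (λ T → lookup (lookup T zero) (suc zero)) same

    same-diagonal : ⌊ a ≟ b ⌋ ≡ ⌊ a′ ≟ b′ ⌋
    same-diagonal = not-injective (≡.cong proj₁ entry₀₁)

    same-adjacency : adj G a b ≡ adj H a′ b′
    same-adjacency = indicator-injective (adj G a b) (adj H a′ b′) (≡.cong proj₂ entry₀₁)
      where
      indicator-injective : ∀ β γ → (if β then 1 else 0) ≡ (if γ then 1 else 0) → β ≡ γ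
      indicator-injective true  true  _ = ≡.refl
      indicator-injective false false _ = ≡.refl
      indicator-injective true  false ()
      indicator-injective false true  ()

  private
    sum-tabulate : ∀ {m} (f : Fin m → ℕ) → Vec.sum (tabulate f) ≡ ℕΣ.sum f
    sum-tabulate {zero}  f = ≡.refl
    sum-tabulate {suc m} f = ≡.cong (f zero ℕ.+_) (sum-tabulate (f ∘ suc))

    deg-permute : ∀ {u u′} (π : Fin n ↔ Fin n) → (∀ m → AdjMat G u m ≡ AdjMat H u′ (Inverse.to π m)) → deg G u ≡ deg H u′
    deg-permute {u} {u′} π rows≡ = begin
      deg G u                               ≡⟨ sum-tabulate (AdjMat G u) ⟩
      ℕΣ.sum (AdjMat G u)                   ≡⟨ ℕΣ.sum-cong-≗ rows≡ ⟩
      ℕΣ.sum (AdjMat H u′ ∘ Inverse.to π)   ≡⟨ ℕΣ.sum-permute (AdjMat H u′) π ⟨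
      ℕΣ.sum (AdjMat H u′)                  ≡⟨ sum-tabulate (AdjMat H u′) ⟨
      deg H u′                              ∎
      where open ≡.≡-Reasoning

  same-degrees : ∀ {a b a′ b′} → Same 1 (a ∷ b ∷ []) (a′ ∷ b′ ∷ []) → deg G a ≡ deg H a′ × deg G b ≡ deg H b′
  same-degrees (_ , π , extensions) =
    deg-permute π (λ m → column zero (proj₁ (extensions m))) , deg-permute π (λ m → column (suc zero) (proj₁ (extensions m)))
    where
    column : ∀ (p : Fin 3) {T U : Vec (Vec (Bool × ℕ) 3) 3} → T ≡ U →
             proj₂ (lookup (lookup T p) (suc (suc zero))) ≡ proj₂ (lookup (lookup U p) (suc (suc zero)))
    column p = ≡.cong (λ T → proj₂ (lookup (lookup T p) (suc (suc zero))))

module WalkTraces (R : CommutativeRing ℓ₁ ℓ₂) {n p} (G H : Graph n) (same-deg : ∀ v → deg G v ≡ deg H v)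
                  (cls : Fin n → Fin p) (partition : IsDegreePartition G cls)
                  (s₀ : CommutativeRing.Carrier R) (s : Fin p → Fin p → CommutativeRing.Carrier R) where

  open import Data.Product using (_×_)
  open CommutativeRing R hiding (zero)
  open MatrixDefs R
  open Summation R
  open Determinant R using (Matrix)
  open MatrixAlgebra R
  open PairSums R
  open ColourRefinement G H
  open import Relation.Binary.Reasoning.Setoid setoid

  W₁ W₂ : Matrix n
  W₁ = Wmat G cls s₀ s
  W₂ = Wmat H cls s₀ s

  private
    same-class : ∀ {u u′} → deg G u ≡ deg H u′ → cls u ≡ cls u′
    same-class {u} {u′} d≡d′ = Equivalence.from (proj₂ partition u u′) (≡.trans d≡d′ (≡.sym (same-deg u′)))

    weight : Bool → Fin p → Fin p → Carrier
    weight β u v = s₀ * ind β + ∑ (λ c → ∑ (λ d → s c d * (ind ⌊ u ≟ c ⌋ * ind ⌊ v ≟ d ⌋)))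

  W-entry : ∀ r {a b a′ b′} → Same (suc r) (a ∷ b ∷ []) (a′ ∷ b′ ∷ []) → W₁ a b ≈ W₂ a′ b′
  W-entry r {a} {b} {a′} {b′} same =
    reflexive (≡.cong₂ (λ β (u , v) → weight β u v) (same-adjacency (Same⇒Same₀ (suc r) {a ∷ b ∷ []} {a′ ∷ b′ ∷ []} same))
                                                       (≡.cong₂ _,_ (same-class (proj₁ degrees)) (same-class (proj₂ degrees))))
    where
    degrees : deg G a ≡ deg H a′ × deg G b ≡ deg H b′
    degrees = same-degrees (Same⇒Same₁ r {a ∷ b ∷ []} {a′ ∷ b′ ∷ []} same)

  power-entry : ∀ k {a b a′ b′} → Same (suc k) (a ∷ b ∷ []) (a′ ∷ b′ ∷ []) → (W₁ ^ k) a b ≈ (W₂ ^ k) a′ b′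
  power-entry zero {a} {b} {a′} {b′} same = reflexive (≡.cong ind (same-diagonal (Same⇒Same₀ 1 {a ∷ b ∷ []} {a′ ∷ b′ ∷ []} same)))
  power-entry (suc k) {a} {b} {a′} {b′} (_ , π , extensions) = begin
    ∑ (λ m → (W₁ ^ k) a m * W₁ m b)
      ≈⟨ ∑-cong (λ m → *-cong (power-entry k (proj₂ (extensions m) (suc zero))) (W-entry k (proj₂ (extensions m) zero))) ⟩
    ∑ (λ m → (W₂ ^ k) a′ (Inverse.to π m) * W₂ (Inverse.to π m) b′)
      ≈⟨ ∑-permute (λ m → (W₂ ^ k) a′ m * W₂ m b′) π ⟨
    ∑ (λ m → (W₂ ^ k) a′ m * W₂ m b′) ∎

  trace-powers : WL2Equiv G H → ∀ k → trace (W₁ ^ k) ≈ trace (W₂ ^ k)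
  trace-powers wl k = begin
    trace (W₁ ^ k)
      ≈⟨ ∑-cong (λ a → ∑-δʳ a ((W₁ ^ k) a)) ⟨
    ∑² (diagonal (W₁ ^ k))
      ≈⟨ ∑-cong (λ a → ∑-cong (λ b → diagonal-entry (a ∷ b ∷ []) (Inverse.to σ (a ∷ b ∷ [])) (same (a ∷ b ∷ [])))) ⟩
    ∑² (diagonal (W₂ ^ k) ∘ Inverse.to σ)
      ≈⟨ ∑²-permute σ (diagonal (W₂ ^ k)) ⟩
    ∑² (diagonal (W₂ ^ k))
      ≈⟨ ∑-cong (λ a → ∑-δʳ a ((W₂ ^ k) a)) ⟩
    trace (W₂ ^ k) ∎
    where
    σ : Vec (Fin n) 2 ↔ Vec (Fin n) 2
    σ = proj₁ (wl (suc k))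
    same : ∀ x → Same (suc k) x (Inverse.to σ x)
    same = proj₂ (wl (suc k))
    diagonal : Matrix n → Vec (Fin n) 2 → Carrier
    diagonal P (a ∷ b ∷ []) = δ a b * P a b
    diagonal-entry : ∀ x y → Same (suc k) x y → diagonal (W₁ ^ k) x ≈ diagonal (W₂ ^ k) y
    diagonal-entry (a ∷ b ∷ []) (a′ ∷ b′ ∷ []) same =
      *-cong (reflexive (≡.cong ind (same-diagonal (Same⇒Same₀ (suc k) {a ∷ b ∷ []} {a′ ∷ b′ ∷ []} same)))) (power-entry k same)


module Specialisation {S : CommutativeRing ℓ₁ ℓ₂} {R : CommutativeRing ℓ₃ ℓ₄} (h : RingHom S R) where

  private
    module S = CommutativeRing S
    module MS = MatrixDefs S
  open CommutativeRing R hiding (zero)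
  open MatrixDefs R
  open Summation R
  open Determinant R using (det-cong)
  open Polynomial S using (X; constant; module Evaluation)
  open Newton S using (module CharacteristicPolynomial)
  open RingHom h using () renaming (⟦_⟧ to ⟦_⟧ₛ)

  evaluate-χ-Wmat : ∀ {n p} (G : Graph n) (cls : Fin n → Fin p) {x₀ x s₀ s} t → ⟦ x₀ ⟧ₛ ≈ s₀ → (∀ a b → ⟦ x a b ⟧ₛ ≈ s a b) →
                    RingHom.⟦ Evaluation.evalHom h t ⟧ (CharacteristicPolynomial.χ (MS.Wmat G cls x₀ x)) ≈ φ G cls s₀ s t
  evaluate-χ-Wmat G cls {x₀} {x} {s₀} {s} t x₀↦s₀ x↦s =
    trans (det-homo (CharacteristicPolynomial.E (MS.Wmat G cls x₀ x))) (det-cong entry)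
    where
    open RingHomProperties (Evaluation.evalHom h t) using (det-homo; charMat-homo)
    open RingHomProperties h using (Wmat-homo)
    entry : ∀ i j → RingHom.⟦ Evaluation.evalHom h t ⟧ (CharacteristicPolynomial.E (MS.Wmat G cls x₀ x) i j) ≈ charMat (Wmat G cls s₀ s) t i j
    entry i j = trans (charMat-homo (λ a b → constant (MS.Wmat G cls x₀ x a b)) X i j) (+-cong (*-congʳ (Evaluation.eval-X h t))
                  (-‿cong (trans (Evaluation.eval-constant h t (MS.Wmat G cls x₀ x i j)) (trans (Wmat-homo G cls x₀ x i j) Wmat≈))))
      where
      Wmat≈ : Wmat G cls ⟦ x₀ ⟧ₛ (λ a b → ⟦ x a b ⟧ₛ) i j ≈ Wmat G cls s₀ s i j
      Wmat≈ = +-cong (*-congʳ x₀↦s₀) (∑-cong (λ c → ∑-cong (λ d → *-congʳ (x↦s c d))))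

module GenericWeights (p : ℕ) where

  private
    m : ℕ
    m = suc (p ℕ.* p)

  ℤ[s] : CommutativeRing 0ℓ 0ℓ
  ℤ[s] = Multivariate m

  ℤ[s]-torsionFree : TorsionFree ℤ[s]
  ℤ[s]-torsionFree = Multivariate-torsionFree m

  open CommutativeRing ℤ[s] using (Carrier)
  open Polynomial ℤ[s] using (Poly; polyRing; module Evaluation)
  open Newton ℤ[s] using (module CharacteristicPolynomial)

  s₀ᵍ : Carrier
  s₀ᵍ = var m zero

  sᵍ : Fin p → Fin p → Carrier
  sᵍ a b = var m (suc (combine {p} a b))

  Wᵍ : ∀ {n} → Graph n → (Fin n → Fin p) → Fin n → Fin n → Carrier
  Wᵍ G cls = MatrixDefs.Wmat ℤ[s] G cls s₀ᵍ sᵍ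

  χᵍ : ∀ {n} → Graph n → (Fin n → Fin p) → Poly
  χᵍ G cls = CharacteristicPolynomial.χ (Wᵍ G cls)

  module _ (R : CommutativeRing ℓ₁ ℓ₂) (s₀ : CommutativeRing.Carrier R) (s : Fin p → Fin p → CommutativeRing.Carrier R) where

    open CommutativeRing R using (_≈_; trans; reflexive)
    open MatrixDefs R using (φ)

    private
      ρ : Fin m → CommutativeRing.Carrier R
      ρ zero    = s₀
      ρ (suc i) = s (proj₁ (remQuot {p} p i)) (proj₂ (remQuot {p} p i))

      assignment : RingHom ℤ[s] R
      assignment = substitute R m ρ

      assignment-sᵍ : ∀ a b → RingHom.⟦ assignment ⟧ (sᵍ a b) ≈ s a b
      assignment-sᵍ a b = trans (substitute-var R m ρ (suc (combine {p} a b)))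
                                (reflexive (≡.cong (λ (c , d) → s c d) (remQuot-combine {p} a b)))

    evaluation : CommutativeRing.Carrier R → RingHom polyRing R
    evaluation = Evaluation.evalHom assignment

    evaluate-χᵍ : ∀ {n} (G : Graph n) (cls : Fin n → Fin p) t → RingHom.⟦ evaluation t ⟧ (χᵍ G cls) ≈ φ G cls s₀ s t
    evaluate-χᵍ G cls t = Specialisation.evaluate-χ-Wmat assignment G cls {s₀ᵍ} {sᵍ} t (substitute-var R m ρ zero) assignment-sᵍ

theorem1p2 : ∀ {n : ℕ} (G H : Graph n) →
    (∀ (v : Fin n) → deg G v ≡ deg H v) →
    WL2Equiv G H →
    ∀ (p : ℕ) (cls : Fin n → Fin p) → IsDegreePartition G cls →
    GBLSEquiv G H cls
theorem1p2 G H same-deg wl p cls partition R s₀ s t = begin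
  φ G cls s₀ s t  ≈⟨ evaluate-χᵍ R s₀ s G cls t ⟨
  ⟦ χᵍ G cls ⟧    ≈⟨ RingHom.cong (evaluation R s₀ s t) same-χᵍ ⟩
  ⟦ χᵍ H cls ⟧    ≈⟨ evaluate-χᵍ R s₀ s H cls t ⟩
  φ H cls s₀ s t  ∎
  where
  open GenericWeights p
  open Polynomial ℤ[s] using (Poly; _≈ₚ_)
  open MatrixDefs R using (φ)
  open import Relation.Binary.Reasoning.Setoid (CommutativeRing.setoid R)
  ⟦_⟧ : Poly → CommutativeRing.Carrier R
  ⟦_⟧ = RingHom.⟦ evaluation R s₀ s t ⟧
  same-χᵍ : χᵍ G cls ≈ₚ χᵍ H cls
  same-χᵍ = Newton.χ-determined-by-traces ℤ[s] ℤ[s]-torsionFree (Wᵍ G cls) (Wᵍ H cls)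
              (WalkTraces.trace-powers ℤ[s] G H same-deg cls partition s₀ᵍ sᵍ wl)
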